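{- For any $n\ge 2$ and $k\ge 0$, in the group algebra $\mathbb{C}[\mathfrak{S}_n]$ we have $$T_n(p_{n-1+k}(\Xi_n)) = T_n(J_n^{\,n-1+k}) = J_2J_3\cdots J_n\cdot h_k(\Xi_n) = e_{n-1}(\Xi_n)\cdot h_k(\Xi_n).$$
   Context: Permutations in $\mathfrak{S}_n$ are multiplied from left to right; a transposition is written $(a\,b)$ with $a<b$. The Jucys–Murphy elements of $\mathbb{C}[\mathfrak{S}_n]$ are $J_1=0$ and $J_k=(1\,k)+(2\,k)+\cdots+(k-1\,k)$ for $2\le k\le n$; they pairwise commute. For a symmetric function $f$ (in variables $x_1,x_2,\dots$), $f(\Xi_n)$ denotes the evaluation $f(J_1,\dots,J_n,0,0,\dots)\in\mathbb{C}[\mathfrak{S}_n]$. Here $p_t$, $h_k$, $e_k$ denote the power sum, complete homogeneous and elementary symmetric functions. Transitivity operator $T_n$: a product of Jucys–Murphy elements $J_{i_1}J_{i_2}\cdots J_{i_t}$ is expanded formally as the sum of all words $\tau_1\tau_2\cdots\tau_t$ with $\tau_r=(j_r\,i_r)$, $j_r<i_r$; $T_n$ of this product is the sum in $\mathbb{C}[\mathfrak{S}_n]$ of the products $\tau_1\cdots\tau_t$ over only those words for which the set $\{\tau_1,\dots,\tau_t\}$ generates a subgroup acting transitively on $[n]$. $T_n$ is extended linearly to linear combinations of such products; in particular $T_n(p_t(\Xi_n))=\sum_{i=1}^n T_n(J_i^t)$. -}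

module Defs where

open import Data.Nat using (ℕ; zero; suc)
open import Data.Fin using (Fin; _<_; _≤_; _<?_; _≤?_; _≟_)
open import Data.Fin.Base using (fromℕ)
open import Data.List using (List; []; _∷_; _++_; map; concatMap; filter; length; lookup; foldl; drop; replicate; allFin)
open import Data.List.Relation.Unary.Linked using (Linked; linked?)
open import Data.List.Relation.Unary.All using (All)
open import Data.List.Membership.Propositional using (_∈_)
open import Data.Product using (_×_; _,_; ∃)
open import Relation.Nullary using (yes; no)
open import Relation.Binary.PropositionalEquality using (_≡_)
open import Function.Bundles using (_↔_)

-- Points of [n] are Fin n (0-based: the point a ∈ Fin n stands for a+1).
-- A transposition (a b) is stored as the pair (a , b); all transpositions
-- arising below have a < b.
Transp : ℕ → Set
Transp n = Fin n × Fin n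

swapT : ∀ {n} → Transp n → Fin n → Fin n
swapT (a , b) x with x ≟ a
... | yes _ = b
... | no _ with x ≟ b
...   | yes _ = a
...   | no _  = x

Word : ℕ → Set
Word n = List (Transp n)

-- the permutation τ₁τ₂⋯τₜ as a map [n] → [n]; products are taken from
-- left to right, so τ₁ acts first: x ↦ τₜ(⋯(τ₁ x)⋯)
act : ∀ {n} → Word n → Fin n → Fin n
act w x = foldl (λ y τ → swapT τ y) x w

-- Elements of the generated subgroup are the products of words in the
-- generators (each generator is an involution, hence its own inverse).
GeneratesTransitive : ∀ {n} → Word n → Set
GeneratesTransitive {n} w =
  (x y : Fin n) → ∃ λ (g : Word n) → All (_∈ w) g × act g x ≡ y

-- A monomial J_{i₁}J_{i₂}⋯J_{iₜ} is the list of indices i₁,…,iₜ (as Fin n,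
-- index i stands for J_{i+1}); a polynomial is a list (formal sum) of
-- monomials, repetitions giving multiplicities.

JMono : ℕ → Set
JMono n = List (Fin n)

JPoly : ℕ → Set
JPoly n = List (JMono n)

expandJ : ∀ {n} → Fin n → List (Transp n)
expandJ {n} i = map (λ j → (j , i)) (filter (_<? i) (allFin n))

expandMono : ∀ {n} → JMono n → List (Word n)
expandMono [] = [] ∷ []
expandMono (i ∷ is) = concatMap (λ τ → map (τ ∷_) (expandMono is)) (expandJ i)

expand : ∀ {n} → JPoly n → List (Word n)
expand = concatMap expandMono

-- A (nonnegative-integer) coefficient is represented by a type whose
-- cardinality is that coefficient; two elements are equal iff for every
-- σ their coefficient types are in bijection.  σ ranges over all maps
-- [n] → [n]; non-bijective σ get coefficient 0 on both sides.

GA : ℕ → Set₁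
GA n = (Fin n → Fin n) → Set

infix 4 _≈GA_
_≈GA_ : ∀ {n} → GA n → GA n → Set
F ≈GA G = ∀ σ → F σ ↔ G σ

record Occ {n} (ws : List (Word n)) (σ : Fin n → Fin n) : Set where
  constructor occ
  field
    idx  : Fin (length ws)
    .hit : ∀ x → act (lookup ws idx) x ≡ σ x

record TOcc {n} (ws : List (Word n)) (σ : Fin n → Fin n) : Set where
  constructor tocc
  field
    idx   : Fin (length ws)
    .tran : GeneratesTransitive (lookup ws idx)
    .hit  : ∀ x → act (lookup ws idx) x ≡ σ x

⟦_⟧ : ∀ {n} → List (Word n) → GA n
⟦ ws ⟧ = Occ ws

evalJ : ∀ {n} → JPoly n → GA n
evalJ P = ⟦ expand P ⟧

Tₙ : ∀ {n} → JPoly n → GA n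
Tₙ P = TOcc (expand P)

_⊛_ : ∀ {n} → List (Word n) → List (Word n) → List (Word n)
A ⊛ B = concatMap (λ u → map (u ++_) B) A

evalMul : ∀ {n} → JPoly n → JPoly n → GA n
evalMul P Q = ⟦ expand P ⊛ expand Q ⟧

-- Symmetric functions evaluated at (J₁,…,Jₙ,0,0,…): only the first n
-- variables survive.

seqs : ∀ n → ℕ → List (JMono n)
seqs n zero = [] ∷ []
seqs n (suc k) = concatMap (λ i → map (i ∷_) (seqs n k)) (allFin n)

pSym : ∀ n → ℕ → JPoly n
pSym n t = map (λ i → replicate t i) (allFin n)

hSym : ∀ n → ℕ → JPoly n
hSym n k = filter (linked? _≤?_) (seqs n k)

eSym : ∀ n → ℕ → JPoly n
eSym n k = filter (linked? _<?_) (seqs n k)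

JlastPow : ∀ m → ℕ → JPoly (suc m)
JlastPow m t = replicate t (fromℕ m) ∷ []

J2toJn : ∀ n → JPoly n
J2toJn n = drop 1 (allFin n) ∷ []

-- For i < N = n-1 no word of J_i^t moves N, so only J_N^t contributes to Tₙ(p_t). A word of J_v^t is
-- a star (j₁ v)⋯(jₜ v) with all jᵣ < v, and for v = N it generates a transitive subgroup exactly
-- when every j < v occurs; call the sum of these words Spanning v t. Splitting off the first letter
-- (i v) and conjugating the words in which i does not occur again, first by (i v) and then by (i u)
-- with u = v-1, gives
--   Spanning v (t+1) = J_v · Spanning v t + Spanning u t · J_v,
-- provided Spanning u t is central in ℂ[𝔖_{u+1}]. That centrality is proved by the same induction,
-- from the relations (u v) J_u + 1 = J_v (u v) and J_u (u v) + 1 = (u v) J_v. Since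
-- h_{k+1}(x₀,…,x_v) = x_v h_k(x₀,…,x_v) + h_{k+1}(x₀,…,x_u), the element J₁⋯J_v · h_k(J₀,…,J_v)
-- satisfies the same recurrence in t = v + k, and both sides vanish for t < v, so
-- Spanning v (v + k) = J₁⋯J_v · h_k(J₀,…,J_v). Finally e_{n-1}(Ξₙ) = J₁⋯J_{n-1} because J₀ = 0.

module Submission where

open import Defs

open import Data.Bool using (Bool; true; false; _∧_; _∨_; not)
import Data.Bool as Bool
open import Data.Bool.Properties using (∧-zeroʳ; ∧-identityʳ; ∨-zeroʳ; T-≡)
open import Data.Empty using (⊥; ⊥-elim; ⊥-elim-irr)
open import Data.Fin using (Fin; zero; suc; toℕ; fromℕ; inject₁; _<_; _≤_; _<?_; _≤?_; _≟_)
import Data.Fin.Properties as Fₚ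
open import Data.Fin.Properties using (all?; toℕ-injective; toℕ-inject₁; toℕ-fromℕ; toℕ≤pred[n]; +↔⊎)
open import Data.Irrelevant using (Irrelevant; [_])
open import Data.List
  using (List; []; _∷_; _++_; _∷ʳ_; map; concatMap; filter; allFin; tabulate; reverse; length; lookup; replicate; drop)
import Data.List.Properties as Listₚ
open import Data.List.Properties
  using (foldl-++; unfold-reverse; map-tabulate; ++-assoc; ++-identityʳ; ∷-injective; map-injective;
         filter-accept; filter-reject; filter-none; filter-all)
open import Data.List.Membership.Propositional using (_∈_; _∉_)
open import Data.List.Membership.Propositional.Properties using (∈-map⁺; ∈-map⁻)
open import Data.List.Relation.Binary.Permutation.Propositional
  using (_↭_; ↭-sym) renaming (refl to ↭-refl; prep to ↭-prep; swap to ↭-swap; trans to ↭-trans)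
open import Data.List.Relation.Binary.Permutation.Propositional.Properties using (shift; ∷↭∷ʳ)
open import Data.List.Relation.Unary.All using (All; []; _∷_)
import Data.List.Relation.Unary.All as All
import Data.List.Relation.Unary.All.Properties as All
open import Data.List.Relation.Unary.All.Properties using (all-filter)
open import Data.List.Relation.Unary.Any using (any?; here; there)
open import Data.List.Relation.Unary.Linked using (Linked; []; [-]; _∷_; linked?)
import Data.List.Relation.Unary.Linked as Linked
open import Data.List.Relation.Unary.Linked.Properties using (Linked⇒All)
open import Data.Nat as ℕ using (ℕ; zero; suc; _+_)
import Data.Nat.Properties as ℕₚ
open import Data.Nat.Properties using (+-assoc; +-comm; +-identityʳ; +-cancelʳ-≡)
open import Algebra.Properties.CommutativeSemigroup ℕₚ.+-commutativeSemigroup using (interchange)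
open import Data.Product using (Σ; _×_; _,_; proj₁; proj₂)
open import Data.Product.Function.NonDependent.Propositional using (_×-⇔_)
open import Data.Product.Properties using () renaming (≡-dec to ×-≡-dec)
open import Data.Sum using (_⊎_; inj₁; inj₂; [_,_]′)
open import Data.Sum.Function.Propositional using (_⊎-↔_)
open import Function using (_∘_; case_of_)
open import Function.Bundles using (_↔_; _⇔_; mk⇔; mk↔ₛ′; Equivalence)
open import Function.Properties.Inverse using (↔-refl; ↔-sym; ↔-trans)
open import Relation.Nullary using (Dec; yes; no; does; ¬_; _×-dec_; _⊎-dec_; _→-dec_)
open import Relation.Nullary.Decidable using (dec-true; dec-false; does-⇔; T?; ¬?)
open import Relation.Unary using (Decidable)
open import Relation.Binary.Bundles using (Setoid)
open import Relation.Binary.Definitions using (tri<; tri≈; tri>)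
open import Relation.Binary.PropositionalEquality hiding (J)
import Relation.Binary.Reasoning.Setoid as SetoidReasoning

private variable
  A B : Set
  n n′ : ℕ

∑ : List A → (A → ℕ) → ℕ
∑ []       F = 0
∑ (x ∷ xs) F = F x + ∑ xs F

when : Bool → ℕ → ℕ
when true  x = x
when false _ = 0

∑-cong : (xs : List A) {F G : A → ℕ} → (∀ x → F x ≡ G x) → ∑ xs F ≡ ∑ xs G
∑-cong []       e = refl
∑-cong (x ∷ xs) e = cong₂ _+_ (e x) (∑-cong xs e)

∑-congᴬ : {P : A → Set} (xs : List A) → All P xs → {F G : A → ℕ} →
          (∀ x → P x → F x ≡ G x) → ∑ xs F ≡ ∑ xs G
∑-congᴬ []       []       e = refl
∑-congᴬ (x ∷ xs) (p ∷ ps) e = cong₂ _+_ (e x p) (∑-congᴬ xs ps e)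

∑-zero : (xs : List A) → ∑ xs (λ _ → 0) ≡ 0
∑-zero []       = refl
∑-zero (x ∷ xs) = ∑-zero xs

∑-++ : (xs ys : List A) (F : A → ℕ) → ∑ (xs ++ ys) F ≡ ∑ xs F + ∑ ys F
∑-++ []       ys F = refl
∑-++ (x ∷ xs) ys F = trans (cong (F x +_) (∑-++ xs ys F)) (sym (+-assoc (F x) _ _))

∑-+ : (xs : List A) (F G : A → ℕ) → ∑ xs (λ x → F x + G x) ≡ ∑ xs F + ∑ xs G
∑-+ []       F G = refl
∑-+ (x ∷ xs) F G = trans (cong (F x + G x +_) (∑-+ xs F G)) (interchange (F x) (G x) _ _)

∑-map : (g : A → B) (xs : List A) (F : B → ℕ) → ∑ (map g xs) F ≡ ∑ xs (F ∘ g)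
∑-map g []       F = refl
∑-map g (x ∷ xs) F = cong (F (g x) +_) (∑-map g xs F)

∑-concatMap : (G : A → List B) (xs : List A) (F : B → ℕ) →
              ∑ (concatMap G xs) F ≡ ∑ xs (λ x → ∑ (G x) F)
∑-concatMap G []       F = refl
∑-concatMap G (x ∷ xs) F =
  trans (∑-++ (G x) (concatMap G xs) F) (cong (∑ (G x) F +_) (∑-concatMap G xs F))

∑-filter : {P : A → Set} (P? : Decidable P) (xs : List A) (F : A → ℕ) →
           ∑ (filter P? xs) F ≡ ∑ xs (λ x → when (does (P? x)) (F x))
∑-filter P? []       F = refl
∑-filter P? (x ∷ xs) F with does (P? x)
... | true  = cong (F x +_) (∑-filter P? xs F)
... | false = ∑-filter P? xs F

∑-comm : (xs : List A) (ys : List B) (G : A → B → ℕ) →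
         ∑ xs (λ x → ∑ ys (G x)) ≡ ∑ ys (λ y → ∑ xs (λ x → G x y))
∑-comm []       ys G = sym (∑-zero ys)
∑-comm (x ∷ xs) ys G =
  trans (cong (∑ ys (G x) +_) (∑-comm xs ys G)) (sym (∑-+ ys (G x) _))

∑-when : (xs : List A) (b : Bool) (F : A → ℕ) → ∑ xs (λ x → when b (F x)) ≡ when b (∑ xs F)
∑-when xs true  F = refl
∑-when xs false F = ∑-zero xs

when-zero : ∀ b → when b 0 ≡ 0
when-zero true  = refl
when-zero false = refl

when-+ : ∀ b x y → when b (x + y) ≡ when b x + when b y
when-+ true  x y = refl
when-+ false x y = refl

when-∧ : ∀ b c x → when (b ∧ c) x ≡ when b (when c x)
when-∧ true  c x = refl
when-∧ false c x = refl

when-cong : ∀ b {x y} → (b ≡ true → x ≡ y) → when b x ≡ when b y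
when-cong true  h = h refl
when-cong false h = refl

when-∨ : ∀ b c x → (b ≡ true → c ≡ false) → when (b ∨ c) x ≡ when b x + when c x
when-∨ true  c x b⇒¬c = trans (sym (+-identityʳ x)) (cong (λ z → x + when z x) (sym (b⇒¬c refl)))
when-∨ false c x _    = refl

true⇒ : {P : Set} (d : Dec P) → does d ≡ true → P
true⇒ (yes p) _ = p

true≢false : true ≢ false
true≢false ()

bool-ext : (b c : Bool) → (b ≡ true → c ≡ true) → (c ≡ true → b ≡ true) → b ≡ c
bool-ext true  true  f g = refl
bool-ext true  false f g = sym (f refl)
bool-ext false true  f g = g refl
bool-ext false false f g = refl

_==_ : Fin n → Fin n → Bool
a == b = does (a ≟ b)

==-refl : (a : Fin n) → (a == a) ≡ true
==-refl a = dec-true (a ≟ a) refl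

==⇒≡ : (a b : Fin n) → (a == b) ≡ true → a ≡ b
==⇒≡ a b = true⇒ (a ≟ b)

≢⇒==-false : (a b : Fin n) → a ≢ b → (a == b) ≡ false
≢⇒==-false a b = dec-false (a ≟ b)

allFin-suc : ∀ n → allFin (suc n) ≡ zero ∷ map suc (allFin n)
allFin-suc n = cong (zero ∷_) (sym (map-tabulate (λ i → i) suc))

∑-allFin-suc : ∀ n (F : Fin (suc n) → ℕ) →
               ∑ (allFin (suc n)) F ≡ F zero + ∑ (allFin n) (F ∘ suc)
∑-allFin-suc n F = trans (cong (λ xs → ∑ xs F) (allFin-suc n)) (cong (F zero +_) (∑-map suc (allFin n) F))

∑-δ : ∀ n (v : Fin n) (G : Fin n → ℕ) → ∑ (allFin n) (λ i → when (i == v) (G i)) ≡ G v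
∑-δ (suc n) zero G = begin
    ∑ (allFin (suc n)) (λ i → when (i == zero) (G i))
  ≡⟨ ∑-allFin-suc n _ ⟩
    G zero + ∑ (allFin n) (λ _ → 0)
  ≡⟨ cong (G zero +_) (∑-zero (allFin n)) ⟩
    G zero + 0
  ≡⟨ +-identityʳ _ ⟩
    G zero ∎
  where open ≡-Reasoning
∑-δ (suc n) (suc v) G = begin
    ∑ (allFin (suc n)) (λ i → when (i == suc v) (G i))
  ≡⟨ ∑-allFin-suc n (λ i → when (i == suc v) (G i)) ⟩
    when (zero == suc v) (G zero) + ∑ (allFin n) (λ i → when (suc i == suc v) (G (suc i)))
  ≡⟨ cong (λ b → when b (G zero) + ∑ (allFin n) (λ i → when (suc i == suc v) (G (suc i))))
          (≢⇒==-false zero (suc v) (λ ())) ⟩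
    ∑ (allFin n) (λ i → when (suc i == suc v) (G (suc i)))
  ≡⟨ ∑-cong (allFin n) (λ i → cong (λ b → when b (G (suc i))) (==-suc i v)) ⟩
    ∑ (allFin n) (λ i → when (i == v) (G (suc i)))
  ≡⟨ ∑-δ n v (G ∘ suc) ⟩
    G (suc v) ∎
  where
  open ≡-Reasoning
  ==-suc : ∀ {n} (i v : Fin n) → (suc i == suc v) ≡ (i == v)
  ==-suc i v with i ≟ v
  ... | yes _ = refl
  ... | no  _ = refl

∑-reindex : ∀ n (ρ ρ⁻¹ : Fin n → Fin n) → (∀ i → ρ⁻¹ (ρ i) ≡ i) → (∀ j → ρ (ρ⁻¹ j) ≡ j) →
            (F : Fin n → ℕ) → ∑ (allFin n) (F ∘ ρ) ≡ ∑ (allFin n) F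
∑-reindex n ρ ρ⁻¹ left right F = begin
    ∑ (allFin n) (F ∘ ρ)
  ≡⟨ ∑-cong (allFin n) (λ i → sym (∑-δ n (ρ i) F)) ⟩
    ∑ (allFin n) (λ i → ∑ (allFin n) (λ j → when (j == ρ i) (F j)))
  ≡⟨ ∑-comm (allFin n) (allFin n) _ ⟩
    ∑ (allFin n) (λ j → ∑ (allFin n) (λ i → when (j == ρ i) (F j)))
  ≡⟨ ∑-cong (allFin n) (λ j → ∑-cong (allFin n) (λ i → cong (λ b → when b (F j)) (graph i j))) ⟩
    ∑ (allFin n) (λ j → ∑ (allFin n) (λ i → when (i == ρ⁻¹ j) (F j)))
  ≡⟨ ∑-cong (allFin n) (λ j → ∑-δ n (ρ⁻¹ j) (λ _ → F j)) ⟩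
    ∑ (allFin n) F ∎
  where
  open ≡-Reasoning
  graph : ∀ i j → (j == ρ i) ≡ (i == ρ⁻¹ j)
  graph i j = bool-ext _ _
    (λ e → subst (λ z → (i == z) ≡ true) (trans (sym (left i)) (cong ρ⁻¹ (sym (==⇒≡ j (ρ i) e)))) (==-refl i))
    (λ e → subst (λ z → (j == z) ≡ true) (trans (sym (right j)) (cong ρ (sym (==⇒≡ i (ρ⁻¹ j) e)))) (==-refl j))

swapT-cases : (a b x : Fin n) →
  (x ≡ a × swapT (a , b) x ≡ b) ⊎
  (x ≢ a × x ≡ b × swapT (a , b) x ≡ a) ⊎
  (x ≢ a × x ≢ b × swapT (a , b) x ≡ x)
swapT-cases a b x with x ≟ a
... | yes x≡a = inj₁ (x≡a , refl)
... | no  x≢a with x ≟ b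
...   | yes x≡b = inj₂ (inj₁ (x≢a , x≡b , refl))
...   | no  x≢b = inj₂ (inj₂ (x≢a , x≢b , refl))

swapT-fst : (a b : Fin n) → swapT (a , b) a ≡ b
swapT-fst a b with swapT-cases a b a
... | inj₁ (_ , e)            = e
... | inj₂ (inj₁ (a≢a , _))   = ⊥-elim (a≢a refl)
... | inj₂ (inj₂ (a≢a , _))   = ⊥-elim (a≢a refl)

swapT-snd : (a b : Fin n) → swapT (a , b) b ≡ a
swapT-snd a b with swapT-cases a b b
... | inj₁ (b≡a , e)           = trans e b≡a
... | inj₂ (inj₁ (_ , _ , e))  = e
... | inj₂ (inj₂ (_ , b≢b , _)) = ⊥-elim (b≢b refl)

swapT-other : (a b x : Fin n) → x ≢ a → x ≢ b → swapT (a , b) x ≡ x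
swapT-other a b x x≢a x≢b with swapT-cases a b x
... | inj₁ (x≡a , _)          = ⊥-elim (x≢a x≡a)
... | inj₂ (inj₁ (_ , x≡b , _)) = ⊥-elim (x≢b x≡b)
... | inj₂ (inj₂ (_ , _ , e))  = e

swapT-involutive : (τ : Transp n) (x : Fin n) → swapT τ (swapT τ x) ≡ x
swapT-involutive (a , b) x with swapT-cases a b x
... | inj₁ (x≡a , e)          = trans (cong (swapT (a , b)) e) (trans (swapT-snd a b) (sym x≡a))
... | inj₂ (inj₁ (_ , x≡b , e)) = trans (cong (swapT (a , b)) e) (trans (swapT-fst a b) (sym x≡b))
... | inj₂ (inj₂ (_ , _ , e))  = trans (cong (swapT (a , b)) e) e

swapT-injective : (τ : Transp n) {x y : Fin n} → swapT τ x ≡ swapT τ y → x ≡ y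
swapT-injective τ {x} {y} e = trans (sym (swapT-involutive τ x)) (trans (cong (swapT τ) e) (swapT-involutive τ y))

swapT-diag : (a x : Fin n) → swapT (a , a) x ≡ x
swapT-diag a x with swapT-cases a a x
... | inj₁ (x≡a , e)          = trans e (sym x≡a)
... | inj₂ (inj₁ (_ , x≡a , e)) = trans e (sym x≡a)
... | inj₂ (inj₂ (_ , _ , e))  = e

swapT-conj : (π : Fin n → Fin n) → (∀ {x y} → π x ≡ π y → x ≡ y) →
             ∀ a b x → π (swapT (a , b) x) ≡ swapT (π a , π b) (π x)
swapT-conj π inj a b x with swapT-cases a b x
... | inj₁ (x≡a , e) =
  trans (cong π e) (sym (trans (cong (λ z → swapT (π a , π b) (π z)) x≡a) (swapT-fst (π a) (π b))))
... | inj₂ (inj₁ (_ , x≡b , e)) =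
  trans (cong π e) (sym (trans (cong (λ z → swapT (π a , π b) (π z)) x≡b) (swapT-snd (π a) (π b))))
... | inj₂ (inj₂ (x≢a , x≢b , e)) =
  trans (cong π e) (sym (swapT-other (π a) (π b) (π x) (x≢a ∘ inj) (x≢b ∘ inj)))

act-++ : (u v : Word n) (x : Fin n) → act (u ++ v) x ≡ act v (act u x)
act-++ u v x = foldl-++ (λ y τ → swapT τ y) x u v

act-reverse-act : (w : Word n) (x : Fin n) → act (reverse w) (act w x) ≡ x
act-reverse-act []      x = refl
act-reverse-act (τ ∷ w) x = begin
    act (reverse (τ ∷ w)) (act w (swapT τ x))
  ≡⟨ cong (λ z → act z (act w (swapT τ x))) (unfold-reverse τ w) ⟩
    act (reverse w ++ τ ∷ []) (act w (swapT τ x))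
  ≡⟨ act-++ (reverse w) (τ ∷ []) _ ⟩
    swapT τ (act (reverse w) (act w (swapT τ x)))
  ≡⟨ cong (swapT τ) (act-reverse-act w (swapT τ x)) ⟩
    swapT τ (swapT τ x)
  ≡⟨ swapT-involutive τ x ⟩
    x ∎
  where open ≡-Reasoning

act-act-reverse : (w : Word n) (x : Fin n) → act w (act (reverse w) x) ≡ x
act-act-reverse []      x = refl
act-act-reverse (τ ∷ w) x = begin
    act w (swapT τ (act (reverse (τ ∷ w)) x))
  ≡⟨ cong (λ z → act w (swapT τ (act z x))) (unfold-reverse τ w) ⟩
    act w (swapT τ (act (reverse w ++ τ ∷ []) x))
  ≡⟨ cong (λ z → act w (swapT τ z)) (act-++ (reverse w) (τ ∷ []) x) ⟩
    act w (swapT τ (swapT τ (act (reverse w) x)))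
  ≡⟨ cong (act w) (swapT-involutive τ _) ⟩
    act w (act (reverse w) x)
  ≡⟨ act-act-reverse w x ⟩
    x ∎
  where open ≡-Reasoning

act-injective : (w : Word n) {x y : Fin n} → act w x ≡ act w y → x ≡ y
act-injective w {x} {y} e =
  trans (sym (act-reverse-act w x)) (trans (cong (act (reverse w)) e) (act-reverse-act w y))

_≐?_ : (f g : Fin n → Fin n) → Dec (∀ x → f x ≡ g x)
f ≐? g = all? (λ x → f x ≟ g x)

δ : Word n → (Fin n → Fin n) → ℕ
δ w f = when (does (act w ≐? f)) 1

δ-⇔ : (u v : Word n) (f g : Fin n → Fin n) →
      ((∀ x → act u x ≡ f x) → (∀ x → act v x ≡ g x)) →
      ((∀ x → act v x ≡ g x) → (∀ x → act u x ≡ f x)) → δ u f ≡ δ v g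
δ-⇔ u v f g to from = cong (λ b → when b 1) (does-⇔ (mk⇔ to from) (act u ≐? f) (act v ≐? g))

δ-word : (u v : Word n) (f : Fin n → Fin n) → (∀ x → act u x ≡ act v x) → δ u f ≡ δ v f
δ-word u v f e = δ-⇔ u v f f (λ h x → trans (sym (e x)) (h x)) (λ h x → trans (e x) (h x))

δ-perm : (u : Word n) (f g : Fin n → Fin n) → (∀ x → f x ≡ g x) → δ u f ≡ δ u g
δ-perm u f g e = δ-⇔ u u f g (λ h x → trans (h x) (e x)) (λ h x → trans (h x) (sym (e x)))

δ-++ʳ : (u v : Word n) (f : Fin n → Fin n) → δ (u ++ v) f ≡ δ v (f ∘ act (reverse u))
δ-++ʳ u v f = δ-⇔ (u ++ v) v f _
  (λ h y → trans (sym (cong (act v) (act-act-reverse u y))) (trans (sym (act-++ u v _)) (h _)))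
  (λ h x → trans (act-++ u v x) (trans (h (act u x)) (cong f (act-reverse-act u x))))

δ-++ˡ : (u v : Word n) (f : Fin n → Fin n) → δ (u ++ v) f ≡ δ u (act (reverse v) ∘ f)
δ-++ˡ u v f = δ-⇔ (u ++ v) u f _
  (λ h x → trans (sym (act-reverse-act v (act u x))) (cong (act (reverse v)) (trans (sym (act-++ u v x)) (h x))))
  (λ h x → trans (act-++ u v x) (trans (cong (act v) (h x)) (act-act-reverse v (f x))))

FSum : ℕ → Set
FSum n = List (Word n)

mult : FSum n → (Fin n → Fin n) → ℕ
mult A f = ∑ A (λ w → δ w f)

infix 4 _≋_
record _≋_ (A B : FSum n) : Set where
  constructor mk≋
  field mult≡ : ∀ f → mult A f ≡ mult B f
open _≋_ public

≋-refl : {A : FSum n} → A ≋ A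
≋-refl = mk≋ (λ f → refl)

≋-reflexive : {A B : FSum n} → A ≡ B → A ≋ B
≋-reflexive refl = ≋-refl

≋-sym : {A B : FSum n} → A ≋ B → B ≋ A
≋-sym e = mk≋ (λ f → sym (mult≡ e f))

≋-trans : {A B C : FSum n} → A ≋ B → B ≋ C → A ≋ C
≋-trans e e′ = mk≋ (λ f → trans (mult≡ e f) (mult≡ e′ f))

≋-setoid : ℕ → Setoid _ _
≋-setoid n = record
  { Carrier = FSum n ; _≈_ = _≋_
  ; isEquivalence = record { refl = ≋-refl ; sym = ≋-sym ; trans = ≋-trans } }

ε : FSum n
ε = [] ∷ []

⟪_⟫ : Transp n → FSum n
⟪ τ ⟫ = (τ ∷ []) ∷ []

mult-++ : (A B : FSum n) (f : Fin n → Fin n) → mult (A ++ B) f ≡ mult A f + mult B f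
mult-++ A B f = ∑-++ A B _

mult-cong : (A : FSum n) (f g : Fin n → Fin n) → (∀ x → f x ≡ g x) → mult A f ≡ mult A g
mult-cong A f g e = ∑-cong A (λ w → δ-perm w f g e)

mult-⊛ : (A B : FSum n) (f : Fin n → Fin n) →
         mult (A ⊛ B) f ≡ ∑ A (λ u → ∑ B (λ v → δ (u ++ v) f))
mult-⊛ A B f = trans (∑-concatMap (λ u → map (u ++_) B) A _) (∑-cong A (λ u → ∑-map (u ++_) B _))

mult-⊛ʳ : (A B : FSum n) (f : Fin n → Fin n) →
          mult (A ⊛ B) f ≡ ∑ A (λ u → mult B (f ∘ act (reverse u)))
mult-⊛ʳ A B f = trans (mult-⊛ A B f) (∑-cong A (λ u → ∑-cong B (λ v → δ-++ʳ u v f)))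

mult-⊛ˡ : (A B : FSum n) (f : Fin n → Fin n) →
          mult (A ⊛ B) f ≡ ∑ B (λ v → mult A (act (reverse v) ∘ f))
mult-⊛ˡ A B f = trans (mult-⊛ A B f) (trans (∑-comm A B _) (∑-cong B (λ v → ∑-cong A (λ u → δ-++ˡ u v f))))

mult-⟪⟫⊛ : (τ : Transp n) (X : FSum n) (f : Fin n → Fin n) → mult (⟪ τ ⟫ ⊛ X) f ≡ mult X (f ∘ swapT τ)
mult-⟪⟫⊛ τ X f = trans (mult-⊛ʳ ⟪ τ ⟫ X f) (+-identityʳ _)

mult-⊛⟪⟫ : (X : FSum n) (τ : Transp n) (f : Fin n → Fin n) → mult (X ⊛ ⟪ τ ⟫) f ≡ mult X (swapT τ ∘ f)
mult-⊛⟪⟫ X τ f = trans (mult-⊛ˡ X ⟪ τ ⟫ f) (+-identityʳ _)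

++-cong : {A A′ B B′ : FSum n} → A ≋ A′ → B ≋ B′ → A ++ B ≋ A′ ++ B′
++-cong {A = A} {A′} {B} {B′} e e′ = mk≋ λ f →
  trans (mult-++ A B f) (trans (cong₂ _+_ (mult≡ e f) (mult≡ e′ f)) (sym (mult-++ A′ B′ f)))

++-congˡ : {A A′ : FSum n} (B : FSum n) → A ≋ A′ → A ++ B ≋ A′ ++ B
++-congˡ B e = ++-cong e (≋-refl {A = B})

++-congʳ : (A : FSum n) {B B′ : FSum n} → B ≋ B′ → A ++ B ≋ A ++ B′
++-congʳ A e = ++-cong (≋-refl {A = A}) e

++-comm≋ : (A B : FSum n) → A ++ B ≋ B ++ A
++-comm≋ A B = mk≋ λ f → trans (mult-++ A B f) (trans (+-comm (mult A f) (mult B f)) (sym (mult-++ B A f)))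

++-assoc≋ : (A B C : FSum n) → (A ++ B) ++ C ≋ A ++ (B ++ C)
++-assoc≋ A B C = mk≋ λ f → cong (λ X → mult X f) (++-assoc A B C)

++-cancelʳ : {A B C : FSum n} → A ++ C ≋ B ++ C → A ≋ B
++-cancelʳ {A = A} {B} {C} e = mk≋ λ f →
  +-cancelʳ-≡ (mult C f) (mult A f) (mult B f) (trans (sym (mult-++ A C f)) (trans (mult≡ e f) (mult-++ B C f)))

⊛-congʳ : (A : FSum n) {B B′ : FSum n} → B ≋ B′ → A ⊛ B ≋ A ⊛ B′
⊛-congʳ A {B} {B′} e = mk≋ λ f →
  trans (mult-⊛ʳ A B f) (trans (∑-cong A (λ u → mult≡ e _)) (sym (mult-⊛ʳ A B′ f)))

⊛-congˡ : {A A′ : FSum n} (B : FSum n) → A ≋ A′ → A ⊛ B ≋ A′ ⊛ B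
⊛-congˡ {A = A} {A′} B e = mk≋ λ f →
  trans (mult-⊛ˡ A B f) (trans (∑-cong B (λ v → mult≡ e _)) (sym (mult-⊛ˡ A′ B f)))

⊛-cong : {A A′ B B′ : FSum n} → A ≋ A′ → B ≋ B′ → A ⊛ B ≋ A′ ⊛ B′
⊛-cong {A′ = A′} {B = B} e e′ = ≋-trans (⊛-congˡ B e) (⊛-congʳ A′ e′)

⊛-assoc : (A B C : FSum n) → (A ⊛ B) ⊛ C ≋ A ⊛ (B ⊛ C)
⊛-assoc A B C = mk≋ λ f → begin
    mult ((A ⊛ B) ⊛ C) f
  ≡⟨ mult-⊛ (A ⊛ B) C f ⟩
    ∑ (A ⊛ B) (λ w → ∑ C (λ z → δ (w ++ z) f))
  ≡⟨ ∑-concatMap (λ u → map (u ++_) B) A _ ⟩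
    ∑ A (λ u → ∑ (map (u ++_) B) (λ w → ∑ C (λ z → δ (w ++ z) f)))
  ≡⟨ ∑-cong A (λ u → ∑-map (u ++_) B _) ⟩
    ∑ A (λ u → ∑ B (λ v → ∑ C (λ z → δ ((u ++ v) ++ z) f)))
  ≡⟨ ∑-cong A (λ u → ∑-cong B (λ v → ∑-cong C (λ z → cong (λ w → δ w f) (++-assoc u v z)))) ⟩
    ∑ A (λ u → ∑ B (λ v → ∑ C (λ z → δ (u ++ (v ++ z)) f)))
  ≡⟨ ∑-cong A (λ u → sym (trans (∑-concatMap (λ v → map (v ++_) C) B _) (∑-cong B (λ v → ∑-map (v ++_) C _)))) ⟩
    ∑ A (λ u → ∑ (B ⊛ C) (λ w → δ (u ++ w) f))
  ≡⟨ sym (mult-⊛ A (B ⊛ C) f) ⟩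
    mult (A ⊛ (B ⊛ C)) f ∎
  where open ≡-Reasoning

⊛-distribˡ : (A B C : FSum n) → A ⊛ (B ++ C) ≋ A ⊛ B ++ A ⊛ C
⊛-distribˡ A B C = mk≋ λ f → begin
    mult (A ⊛ (B ++ C)) f
  ≡⟨ mult-⊛ A (B ++ C) f ⟩
    ∑ A (λ u → ∑ (B ++ C) (λ v → δ (u ++ v) f))
  ≡⟨ ∑-cong A (λ u → ∑-++ B C _) ⟩
    ∑ A (λ u → ∑ B (λ v → δ (u ++ v) f) + ∑ C (λ v → δ (u ++ v) f))
  ≡⟨ ∑-+ A _ _ ⟩
    ∑ A (λ u → ∑ B (λ v → δ (u ++ v) f)) + ∑ A (λ u → ∑ C (λ v → δ (u ++ v) f))
  ≡⟨ sym (cong₂ _+_ (mult-⊛ A B f) (mult-⊛ A C f)) ⟩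
    mult (A ⊛ B) f + mult (A ⊛ C) f
  ≡⟨ sym (mult-++ (A ⊛ B) (A ⊛ C) f) ⟩
    mult (A ⊛ B ++ A ⊛ C) f ∎
  where open ≡-Reasoning

⊛-distribʳ : (A B C : FSum n) → (A ++ B) ⊛ C ≋ A ⊛ C ++ B ⊛ C
⊛-distribʳ A B C = mk≋ λ f → begin
    mult ((A ++ B) ⊛ C) f
  ≡⟨ mult-⊛ (A ++ B) C f ⟩
    ∑ (A ++ B) (λ u → ∑ C (λ v → δ (u ++ v) f))
  ≡⟨ ∑-++ A B _ ⟩
    ∑ A (λ u → ∑ C (λ v → δ (u ++ v) f)) + ∑ B (λ u → ∑ C (λ v → δ (u ++ v) f))
  ≡⟨ sym (cong₂ _+_ (mult-⊛ A C f) (mult-⊛ B C f)) ⟩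
    mult (A ⊛ C) f + mult (B ⊛ C) f
  ≡⟨ sym (mult-++ (A ⊛ C) (B ⊛ C) f) ⟩
    mult (A ⊛ C ++ B ⊛ C) f ∎
  where open ≡-Reasoning

⊛-identityˡ : (A : FSum n) → ε ⊛ A ≋ A
⊛-identityˡ A = mk≋ λ f → trans (mult-⊛ ε A f) (+-identityʳ _)

⊛-identityʳ : (A : FSum n) → A ⊛ ε ≋ A
⊛-identityʳ A = mk≋ λ f →
  trans (mult-⊛ A ε f) (∑-cong A (λ u → trans (+-identityʳ _) (cong (λ w → δ w f) (++-identityʳ u))))

⊛-zeroʳ : (A : FSum n) → A ⊛ [] ≋ []
⊛-zeroʳ A = mk≋ λ f → trans (mult-⊛ A [] f) (∑-zero A)

-- Coefficients as cardinalities

Positions : (P : A → Set) → List A → Set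
Positions P xs = Σ (Fin (length xs)) (λ i → Irrelevant (P (lookup xs i)))

count : {P : A → Set} → Decidable P → List A → ℕ
count P? xs = ∑ xs (λ x → when (does (P? x)) 1)

Irrelevant↔Fin : {P : Set} (P? : Dec P) → Irrelevant P ↔ Fin (when (does P?) 1)
Irrelevant↔Fin (yes p) = mk↔ₛ′ (λ _ → zero) (λ _ → [ p ]) (λ { zero → refl }) (λ _ → refl)
Irrelevant↔Fin (no ¬p) = mk↔ₛ′ (λ { [ p ] → ⊥-elim-irr (¬p p) }) (λ ()) (λ ()) (λ { [ p ] → ⊥-elim-irr (¬p p) })

Irrelevant-cong : {P Q : Set} → P ⇔ Q → Irrelevant P ↔ Irrelevant Q
Irrelevant-cong P⇔Q = mk↔ₛ′ (λ { [ p ] → [ Equivalence.to P⇔Q p ] }) (λ { [ q ] → [ Equivalence.from P⇔Q q ] })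
                             (λ _ → refl) (λ _ → refl)

Positions-∷ : (P : A → Set) (x : A) (xs : List A) → Positions P (x ∷ xs) ↔ (Irrelevant (P x) ⊎ Positions P xs)
Positions-∷ P x xs = mk↔ₛ′ to from (λ { (inj₁ _) → refl ; (inj₂ _) → refl }) (λ { (zero , _) → refl ; (suc _ , _) → refl })
  where
  to : Positions P (x ∷ xs) → Irrelevant (P x) ⊎ Positions P xs
  to (zero  , p) = inj₁ p
  to (suc i , p) = inj₂ (i , p)
  from : Irrelevant (P x) ⊎ Positions P xs → Positions P (x ∷ xs)
  from (inj₁ p)       = zero , p
  from (inj₂ (i , p)) = suc i , p

Positions-[] : (P Q : A → Set) → Positions P [] ↔ Positions Q []
Positions-[] P Q = mk↔ₛ′ (λ { (() , _) }) (λ { (() , _) }) (λ { (() , _) }) (λ { (() , _) })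

Positions↔count : {P : A → Set} (P? : Decidable P) (xs : List A) → Positions P xs ↔ Fin (count P? xs)
Positions↔count P? []       = mk↔ₛ′ (λ { (() , _) }) (λ ()) (λ ()) (λ { (() , _) })
Positions↔count P? (x ∷ xs) =
  ↔-trans (Positions-∷ _ x xs) (↔-trans (Irrelevant↔Fin (P? x) ⊎-↔ Positions↔count P? xs) (↔-sym +↔⊎))

Positions-cong : {P Q : A → Set} (xs : List A) → All (λ x → P x ⇔ Q x) xs → Positions P xs ↔ Positions Q xs
Positions-cong {P = P} {Q} []       []       = Positions-[] P Q
Positions-cong {P = P} {Q} (x ∷ xs) (e ∷ es) =
  ↔-trans (Positions-∷ P x xs) (↔-trans (Irrelevant-cong e ⊎-↔ Positions-cong xs es) (↔-sym (Positions-∷ Q x xs)))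

Fin-cong : {a b : ℕ} → a ≡ b → Fin a ↔ Fin b
Fin-cong refl = ↔-refl

⟦⟧↔mult : (A : FSum n) (σ : Fin n → Fin n) → ⟦ A ⟧ σ ↔ Fin (mult A σ)
⟦⟧↔mult A σ = ↔-trans occurrences (Positions↔count (λ w → act w ≐? σ) A)
  where
  occurrences : ⟦ A ⟧ σ ↔ Positions (λ w → ∀ x → act w x ≡ σ x) A
  occurrences = mk↔ₛ′ (λ { (occ i h) → i , [ h ] }) (λ { (i , [ h ]) → occ i h }) (λ _ → refl) (λ _ → refl)

≈GA-trans : {F G K : GA n} → F ≈GA G → G ≈GA K → F ≈GA K
≈GA-trans F≈G G≈K σ = ↔-trans (F≈G σ) (G≈K σ)

≈GA-sym : {F G : GA n} → F ≈GA G → G ≈GA F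
≈GA-sym F≈G σ = ↔-sym (F≈G σ)

≋⇒≈GA : {A B : FSum n} → A ≋ B → ⟦ A ⟧ ≈GA ⟦ B ⟧
≋⇒≈GA {A = A} {B} e σ = ↔-trans (⟦⟧↔mult A σ) (↔-trans (Fin-cong (mult≡ e σ)) (↔-sym (⟦⟧↔mult B σ)))

Tₙ≈filter : {S : Word n → Set} (S? : Decidable S) (P : JPoly n) →
            All (λ w → GeneratesTransitive w ⇔ S w) (expand P) → Tₙ P ≈GA ⟦ filter S? (expand P) ⟧
Tₙ≈filter {S = S} S? P transitive⇔S σ =
  ↔-trans occurrences
    (↔-trans (Positions-cong {P = λ w → GeneratesTransitive w × (∀ x → act w x ≡ σ x)}
                             {Q = λ w → S w × (∀ x → act w x ≡ σ x)}
                             (expand P) (All.map (_×-⇔ mk⇔ (λ h → h) (λ h → h)) transitive⇔S))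
      (↔-trans (Positions↔count (λ w → S? w ×-dec (act w ≐? σ)) (expand P))
        (↔-trans (Fin-cong counts) (↔-sym (⟦⟧↔mult (filter S? (expand P)) σ)))))
  where
  occurrences : Tₙ P σ ↔ Positions (λ w → GeneratesTransitive w × (∀ x → act w x ≡ σ x)) (expand P)
  occurrences = mk↔ₛ′ (λ { (tocc i t h) → i , [ t , h ] }) (λ { (i , [ th ]) → tocc i (proj₁ th) (proj₂ th) })
                      (λ _ → refl) (λ _ → refl)
  counts : count (λ w → S? w ×-dec (act w ≐? σ)) (expand P) ≡ mult (filter S? (expand P)) σ
  counts = trans (∑-cong (expand P) (λ w → when-∧ (does (S? w)) _ 1)) (sym (∑-filter S? (expand P) _))

-- Jucys–Murphy elements

_<ᵇ_ : Fin n → Fin n → Bool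
a <ᵇ b = does (a <? b)

J : Fin n → FSum n
J v = expandMono (v ∷ [])

∑-expandJ : (v : Fin n) (G : Transp n → ℕ) → ∑ (expandJ v) G ≡ ∑ (allFin n) (λ j → when (j <ᵇ v) (G (j , v)))
∑-expandJ {n} v G = trans (∑-map (λ j → (j , v)) (filter (_<? v) (allFin n)) G) (∑-filter (_<? v) (allFin n) _)

∑-expandMono-∷ : (i : Fin n) (is : JMono n) (G : Word n → ℕ) →
  ∑ (expandMono (i ∷ is)) G ≡ ∑ (allFin n) (λ j → when (j <ᵇ i) (∑ (expandMono is) (λ w → G ((j , i) ∷ w))))
∑-expandMono-∷ i is G = trans (∑-concatMap (λ τ → map (τ ∷_) (expandMono is)) (expandJ i) G)
  (trans (∑-cong (expandJ i) (λ τ → ∑-map (τ ∷_) (expandMono is) G)) (∑-expandJ i _))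

∑-J : (v : Fin n) (G : Word n → ℕ) → ∑ (J v) G ≡ ∑ (allFin n) (λ j → when (j <ᵇ v) (G ((j , v) ∷ [])))
∑-J {n} v G = trans (∑-expandMono-∷ v [] G) (∑-cong (allFin n) (λ j → cong (when (j <ᵇ v)) (+-identityʳ _)))

∑-expandMono-++ : (xs ys : JMono n) (G : Word n → ℕ) →
  ∑ (expandMono (xs ++ ys)) G ≡ ∑ (expandMono xs) (λ u → ∑ (expandMono ys) (λ v → G (u ++ v)))
∑-expandMono-++ []       ys G = sym (+-identityʳ _)
∑-expandMono-++ {n} (x ∷ xs) ys G = begin
    ∑ (expandMono (x ∷ xs ++ ys)) G
  ≡⟨ ∑-expandMono-∷ x (xs ++ ys) G ⟩
    ∑ (allFin n) (λ j → when (j <ᵇ x) (∑ (expandMono (xs ++ ys)) (λ w → G ((j , x) ∷ w))))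
  ≡⟨ ∑-cong (allFin n) (λ j → cong (when (j <ᵇ x)) (∑-expandMono-++ xs ys (λ w → G ((j , x) ∷ w)))) ⟩
    ∑ (allFin n) (λ j → when (j <ᵇ x) (∑ (expandMono xs) (λ u → ∑ (expandMono ys) (λ v → G ((j , x) ∷ u ++ v)))))
  ≡⟨ sym (∑-expandMono-∷ x xs _) ⟩
    ∑ (expandMono (x ∷ xs)) (λ u → ∑ (expandMono ys) (λ v → G (u ++ v))) ∎
  where open ≡-Reasoning

expandMono-++ : (xs ys : JMono n) → expandMono (xs ++ ys) ≋ expandMono xs ⊛ expandMono ys
expandMono-++ xs ys = mk≋ λ f →
  trans (∑-expandMono-++ xs ys (λ w → δ w f)) (sym (mult-⊛ (expandMono xs) (expandMono ys) f))

WordBelow : Fin n → Word n → Set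
WordBelow c = All (λ τ → proj₁ τ < c × proj₂ τ < c)

SumBelow : Fin n → FSum n → Set
SumBelow c = All (WordBelow c)

All-concatMap : {P : B → Set} (f : A → List B) (xs : List A) → All (All P ∘ f) xs → All P (concatMap f xs)
All-concatMap f xs h = All.concat⁺ (All.map⁺ h)

SumBelow-expandMono : (c : Fin n) (is : JMono n) → All (_< c) is → SumBelow c (expandMono is)
SumBelow-expandMono c []       []             = [] ∷ []
SumBelow-expandMono {n} c (x ∷ xs) (x<c ∷ xs<c) =
  All-concatMap (λ τ → map (τ ∷_) (expandMono xs)) (expandJ x)
    (All.map⁺ (All.map (λ j<x → All.map⁺ (All.map ((ℕₚ.<-trans j<x x<c , x<c) ∷_) (SumBelow-expandMono c xs xs<c)))
                       (all-filter (_<? x) (allFin n))))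

SumBelow-J : {v c : Fin n} → v < c → SumBelow c (J v)
SumBelow-J {v = v} {c} v<c = SumBelow-expandMono c (v ∷ []) (v<c ∷ [])

SumBelow-⟪⟫ : {a b c : Fin n} → a < c → b < c → SumBelow c ⟪ (a , b) ⟫
SumBelow-⟪⟫ a<c b<c = ((a<c , b<c) ∷ []) ∷ []

act-fixes-above : (c : Fin n) (w : Word n) → WordBelow c w → ∀ x → ¬ x < c → act w x ≡ x
act-fixes-above c []            []                  x x≮c = refl
act-fixes-above c ((a , b) ∷ w) ((a<c , b<c) ∷ wc) x x≮c =
  trans (cong (act w) (swapT-other a b x (λ { refl → x≮c a<c }) (λ { refl → x≮c b<c }))) (act-fixes-above c w wc x x≮c)

act-keeps-below : (c : Fin n) (w : Word n) → WordBelow c w → ∀ x → x < c → act w x < c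
act-keeps-below c []            []                  x x<c = x<c
act-keeps-below c ((a , b) ∷ w) ((a<c , b<c) ∷ wc) x x<c = act-keeps-below c w wc _ swapped<c
  where
  swapped<c : swapT (a , b) x < c
  swapped<c with swapT-cases a b x
  ... | inj₁ (_ , e)            = subst (_< c) (sym e) b<c
  ... | inj₂ (inj₁ (_ , _ , e)) = subst (_< c) (sym e) a<c
  ... | inj₂ (inj₂ (_ , _ , e)) = subst (_< c) (sym e) x<c

<ᵇ-act : (c : Fin n) (w : Word n) → WordBelow c w → ∀ x → (act w x <ᵇ c) ≡ (x <ᵇ c)
<ᵇ-act c w wc x with x <? c
... | yes x<c = trans (dec-true (act w x <? c) (act-keeps-below c w wc x x<c)) (sym (dec-true (x <? c) x<c))
... | no  x≮c = cong (_<ᵇ c) (act-fixes-above c w wc x x≮c)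

-- Conjugation by a word supported below v permutes the letters (j v), j < v.
J-comm-word : (v : Fin n) (w : Word n) → WordBelow v w → ∀ f →
  ∑ (allFin n) (λ j → when (j <ᵇ v) (δ ((j , v) ∷ w) f)) ≡ ∑ (allFin n) (λ j → when (j <ᵇ v) (δ (w ++ (j , v) ∷ []) f))
J-comm-word {n} v w wv f = sym (begin
    ∑ (allFin n) (λ j → when (j <ᵇ v) (δ (w ++ (j , v) ∷ []) f))
  ≡⟨ ∑-cong (allFin n) (λ j → cong₂ when (cong (_<ᵇ v) (sym (act-act-reverse w j)))
                                          (δ-word (w ++ (j , v) ∷ []) ((π⁻¹ j , v) ∷ w) f (conjugate j))) ⟩
    ∑ (allFin n) (K ∘ π⁻¹)
  ≡⟨ ∑-reindex n π⁻¹ π (act-act-reverse w) (act-reverse-act w) K ⟩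
    ∑ (allFin n) K
  ≡⟨ ∑-cong (allFin n) (λ j → cong (λ b → when b (δ ((j , v) ∷ w) f)) (<ᵇ-act v w wv j)) ⟩
    ∑ (allFin n) (λ j → when (j <ᵇ v) (δ ((j , v) ∷ w) f)) ∎)
  where
  open ≡-Reasoning
  π = act w
  π⁻¹ = act (reverse w)
  K : Fin n → ℕ
  K a = when (π a <ᵇ v) (δ ((a , v) ∷ w) f)
  conjugate : ∀ j x → act (w ++ (j , v) ∷ []) x ≡ act ((π⁻¹ j , v) ∷ w) x
  conjugate j x = begin
      act (w ++ (j , v) ∷ []) x
    ≡⟨ act-++ w ((j , v) ∷ []) x ⟩
      swapT (j , v) (π x)
    ≡⟨ sym (cong₂ (λ a b → swapT (a , b) (π x)) (act-act-reverse w j) (act-fixes-above v w wv v (ℕₚ.<-irrefl refl))) ⟩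
      swapT (π (π⁻¹ j) , π v) (π x)
    ≡⟨ sym (swapT-conj π (act-injective w) (π⁻¹ j) v x) ⟩
      π (swapT (π⁻¹ j , v) x) ∎

J-comm-below : (v : Fin n) (A : FSum n) → SumBelow v A → J v ⊛ A ≋ A ⊛ J v
J-comm-below {n} v A Av = mk≋ λ f → begin
    mult (J v ⊛ A) f
  ≡⟨ mult-⊛ (J v) A f ⟩
    ∑ (J v) (λ u → ∑ A (λ w → δ (u ++ w) f))
  ≡⟨ ∑-comm (J v) A _ ⟩
    ∑ A (λ w → ∑ (J v) (λ u → δ (u ++ w) f))
  ≡⟨ ∑-cong A (λ w → ∑-J v _) ⟩
    ∑ A (λ w → ∑ (allFin n) (λ j → when (j <ᵇ v) (δ ((j , v) ∷ w) f)))
  ≡⟨ ∑-congᴬ A Av (λ w wv → J-comm-word v w wv f) ⟩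
    ∑ A (λ w → ∑ (allFin n) (λ j → when (j <ᵇ v) (δ (w ++ (j , v) ∷ []) f)))
  ≡⟨ sym (∑-cong A (λ w → ∑-J v _)) ⟩
    ∑ A (λ w → ∑ (J v) (λ u → δ (w ++ u) f))
  ≡⟨ sym (mult-⊛ A (J v) f) ⟩
    mult (A ⊛ J v) f ∎
  where open ≡-Reasoning

⟪⟫-comm-below : (c a b : Fin n) (A : FSum n) → SumBelow c A → ¬ a < c → ¬ b < c → ⟪ (a , b) ⟫ ⊛ A ≋ A ⊛ ⟪ (a , b) ⟫
⟪⟫-comm-below c a b A Ac a≮c b≮c = mk≋ λ f →
  trans (mult-⊛ ⟪ (a , b) ⟫ A f) (trans (+-identityʳ _)
    (trans (∑-congᴬ A Ac (λ w wc → trans (δ-word ((a , b) ∷ w) (w ++ (a , b) ∷ []) f (commute w wc)) (sym (+-identityʳ _))))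
      (sym (mult-⊛ A ⟪ (a , b) ⟫ f))))
  where
  commute : ∀ w → WordBelow c w → ∀ x → act ((a , b) ∷ w) x ≡ act (w ++ (a , b) ∷ []) x
  commute w wc x = begin
      act w (swapT (a , b) x)
    ≡⟨ swapT-conj (act w) (act-injective w) a b x ⟩
      swapT (act w a , act w b) (act w x)
    ≡⟨ cong₂ (λ p q → swapT (p , q) (act w x)) (act-fixes-above c w wc a a≮c) (act-fixes-above c w wc b b≮c) ⟩
      swapT (a , b) (act w x)
    ≡⟨ sym (act-++ w ((a , b) ∷ []) x) ⟩
      act (w ++ (a , b) ∷ []) x ∎
    where open ≡-Reasoning

-- Star words

∑-seqs-suc : ∀ n k (G : JMono n → ℕ) → ∑ (seqs n (suc k)) G ≡ ∑ (allFin n) (λ i → ∑ (seqs n k) (λ s → G (i ∷ s)))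
∑-seqs-suc n k G = trans (∑-concatMap (λ i → map (i ∷_) (seqs n k)) (allFin n) G)
                         (∑-cong (allFin n) (λ i → ∑-map (i ∷_) (seqs n k) G))

∑-seqs-reindex : ∀ n k (ρ ρ⁻¹ : Fin n → Fin n) → (∀ i → ρ⁻¹ (ρ i) ≡ i) → (∀ j → ρ (ρ⁻¹ j) ≡ j) →
                 (F : JMono n → ℕ) → ∑ (seqs n k) (F ∘ map ρ) ≡ ∑ (seqs n k) F
∑-seqs-reindex n zero    ρ ρ⁻¹ left right F = refl
∑-seqs-reindex n (suc k) ρ ρ⁻¹ left right F = begin
    ∑ (seqs n (suc k)) (F ∘ map ρ)
  ≡⟨ ∑-seqs-suc n k _ ⟩
    ∑ (allFin n) (λ i → ∑ (seqs n k) (λ s → F (ρ i ∷ map ρ s)))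
  ≡⟨ ∑-cong (allFin n) (λ i → ∑-seqs-reindex n k ρ ρ⁻¹ left right (λ s → F (ρ i ∷ s))) ⟩
    ∑ (allFin n) (λ i → ∑ (seqs n k) (λ s → F (ρ i ∷ s)))
  ≡⟨ ∑-reindex n ρ ρ⁻¹ left right (λ i → ∑ (seqs n k) (λ s → F (i ∷ s))) ⟩
    ∑ (allFin n) (λ i → ∑ (seqs n k) (λ s → F (i ∷ s)))
  ≡⟨ sym (∑-seqs-suc n k F) ⟩
    ∑ (seqs n (suc k)) F ∎
  where open ≡-Reasoning

star : Fin n → List (Fin n) → Word n
star v = map (λ a → (a , v))

allBelow : Fin n → List (Fin n) → Bool
allBelow v s = does (All.all? (_<? v) s)

∑-expandMono-replicate : ∀ t (v : Fin n) (G : Word n → ℕ) →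
  ∑ (expandMono (replicate t v)) G ≡ ∑ (seqs n t) (λ s → when (allBelow v s) (G (star v s)))
∑-expandMono-replicate zero    v G = refl
∑-expandMono-replicate {n} (suc t) v G = begin
    ∑ (expandMono (v ∷ replicate t v)) G
  ≡⟨ ∑-expandMono-∷ v (replicate t v) G ⟩
    ∑ (allFin n) (λ j → when (j <ᵇ v) (∑ (expandMono (replicate t v)) (λ w → G ((j , v) ∷ w))))
  ≡⟨ ∑-cong (allFin n) (λ j → cong (when (j <ᵇ v)) (∑-expandMono-replicate t v (λ w → G ((j , v) ∷ w)))) ⟩
    ∑ (allFin n) (λ j → when (j <ᵇ v) (∑ (seqs n t) (λ s → when (allBelow v s) (G (star v (j ∷ s))))))
  ≡⟨ ∑-cong (allFin n) (λ j → sym (trans (∑-cong (seqs n t) (λ s → when-∧ (j <ᵇ v) _ _)) (∑-when (seqs n t) (j <ᵇ v) _))) ⟩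
    ∑ (allFin n) (λ j → ∑ (seqs n t) (λ s → when (allBelow v (j ∷ s)) (G (star v (j ∷ s)))))
  ≡⟨ sym (∑-seqs-suc n t _) ⟩
    ∑ (seqs n (suc t)) (λ s → when (allBelow v s) (G (star v s))) ∎
  where open ≡-Reasoning

Stars : Fin n → (JMono n → Bool) → ℕ → FSum n
Stars {n} v P t = map (star v) (filter (T? ∘ P) (seqs n t))

∑-Stars : (v : Fin n) (P : JMono n → Bool) (t : ℕ) (G : Word n → ℕ) →
          ∑ (Stars v P t) G ≡ ∑ (seqs n t) (λ s → when (P s) (G (star v s)))
∑-Stars {n} v P t G = trans (∑-map (star v) (filter (T? ∘ P) (seqs n t)) G) (∑-filter (T? ∘ P) (seqs n t) _)

Stars-cong : (v : Fin n) (P Q : JMono n → Bool) (t : ℕ) → (∀ s → P s ≡ Q s) → Stars v P t ≋ Stars v Q t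
Stars-cong {n} v P Q t e = mk≋ λ f →
  trans (∑-Stars v P t _) (trans (∑-cong (seqs n t) (λ s → cong (λ b → when b (δ (star v s) f)) (e s))) (sym (∑-Stars v Q t _)))

act-star-conj : (p q v : Fin n) (s : List (Fin n)) (x : Fin n) → let σ = swapT (p , q) in
                act (star (σ v) (map σ s)) (σ x) ≡ σ (act (star v s) x)
act-star-conj p q v []      x = refl
act-star-conj p q v (a ∷ s) x =
  trans (cong (act (star (σ v) (map σ s))) (sym (swapT-conj σ (swapT-injective (p , q)) a v x)))
        (act-star-conj p q v s (swapT (a , v) x))
  where σ = swapT (p , q)

Stars-conj : (p q v : Fin n) (P : JMono n → Bool) (t : ℕ) (f : Fin n → Fin n) → let σ = swapT (p , q) in
             mult (Stars v P t) (σ ∘ f ∘ σ) ≡ mult (Stars (σ v) (P ∘ map σ) t) f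
Stars-conj {n} p q v P t f = begin
    mult (Stars v P t) (σ ∘ f ∘ σ)
  ≡⟨ ∑-Stars v P t _ ⟩
    ∑ (seqs n t) (λ s → when (P s) (δ (star v s) (σ ∘ f ∘ σ)))
  ≡⟨ ∑-cong (seqs n t) (λ s → cong₂ when (cong P (sym (map-involutive s))) (conjugate s)) ⟩
    ∑ (seqs n t) (F ∘ map σ)
  ≡⟨ ∑-seqs-reindex n t σ σ σσ σσ F ⟩
    ∑ (seqs n t) F
  ≡⟨ sym (∑-Stars (σ v) (P ∘ map σ) t _) ⟩
    mult (Stars (σ v) (P ∘ map σ) t) f ∎
  where
  open ≡-Reasoning
  σ = swapT (p , q)
  σσ = swapT-involutive (p , q)
  F : JMono n → ℕ
  F s = when (P (map σ s)) (δ (star (σ v) s) f)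
  map-involutive : ∀ s → map σ (map σ s) ≡ s
  map-involutive []      = refl
  map-involutive (a ∷ s) = cong₂ _∷_ (σσ a) (map-involutive s)
  conjugate : ∀ s → δ (star v s) (σ ∘ f ∘ σ) ≡ δ (star (σ v) (map σ s)) f
  conjugate s = δ-⇔ (star v s) (star (σ v) (map σ s)) (σ ∘ f ∘ σ) f
    (λ h y → trans (cong (act (star (σ v) (map σ s))) (sym (σσ y)))
               (trans (act-star-conj p q v s (σ y)) (trans (cong σ (h (σ y))) (trans (σσ _) (cong f (σσ y))))))
    (λ h x → trans (sym (σσ _)) (trans (cong σ (sym (act-star-conj p q v s x))) (cong σ (h (σ x)))))

_∈ᵇ_ : Fin n → List (Fin n) → Bool
a ∈ᵇ []      = false
a ∈ᵇ (b ∷ s) = (a == b) ∨ (a ∈ᵇ s)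

HasElems : (Fin n → Bool) → List (Fin n) → Set
HasElems L s = ∀ a → (a ∈ᵇ s) ≡ L a

hasElems? : (L : Fin n → Bool) (s : List (Fin n)) → Dec (HasElems L s)
hasElems? L s = all? (λ a → (a ∈ᵇ s) Bool.≟ L a)

hasElems : (Fin n → Bool) → List (Fin n) → Bool
hasElems L s = does (hasElems? L s)

hasElems-false : (L : Fin n → Bool) (s : List (Fin n)) (a : Fin n) → (a ∈ᵇ s) ≢ L a → hasElems L s ≡ false
hasElems-false L s a ne = dec-false (hasElems? L s) (λ h → ne (h a))

∈ᵇ-head : (i : Fin n) (s : List (Fin n)) → (i ∈ᵇ (i ∷ s)) ≡ true
∈ᵇ-head i s = cong (_∨ (i ∈ᵇ s)) (==-refl i)

∈ᵇ-self : (s : List (Fin n)) → All (λ a → (a ∈ᵇ s) ≡ true) s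
∈ᵇ-self []      = []
∈ᵇ-self (a ∷ s) = ∈ᵇ-head a s ∷ All.map (λ {b} b∈s → trans (cong ((b == a) ∨_) b∈s) (∨-zeroʳ (b == a))) (∈ᵇ-self s)

hasElems-away : (i : Fin n) (L L′ : Fin n → Bool) (s s′ : List (Fin n)) →
  (∀ a → (a == i) ≡ false → (a ∈ᵇ s) ≡ (a ∈ᵇ s′)) → (∀ a → (a == i) ≡ false → L a ≡ L′ a) →
  (i ∈ᵇ s) ≡ L i → (i ∈ᵇ s′) ≡ L′ i → hasElems L s ≡ hasElems L′ s′
hasElems-away {n} i L L′ s s′ same-∈ same-L at-i at-i′ =
  does-⇔ (mk⇔ (λ h a → transfer L L′ s s′ a h same-∈ same-L at-i′)
              (λ h a → transfer L′ L s′ s a h (λ b e → sym (same-∈ b e)) (λ b e → sym (same-L b e)) at-i))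
         (hasElems? L s) (hasElems? L′ s′)
  where
  transfer : ∀ (M M′ : Fin n → Bool) r r′ a → HasElems M r →
    (∀ a → (a == i) ≡ false → (a ∈ᵇ r) ≡ (a ∈ᵇ r′)) → (∀ a → (a == i) ≡ false → M a ≡ M′ a) →
    (i ∈ᵇ r′) ≡ M′ i → (a ∈ᵇ r′) ≡ M′ a
  transfer M M′ r r′ a h same-∈ same-M at with a == i in e
  ... | true  = subst (λ z → (z ∈ᵇ r′) ≡ M′ z) (sym (==⇒≡ a i e)) at
  ... | false = trans (sym (same-∈ a e)) (trans (h a) (same-M a e))

below : Fin n → Fin n → Bool
below v a = a <ᵇ v

_∖_ : (Fin n → Bool) → Fin n → Fin n → Bool
(L ∖ i) a = L a ∧ not (a == i)

∖-away : (L : Fin n → Bool) (i a : Fin n) → (a == i) ≡ false → (L ∖ i) a ≡ L a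
∖-away L i a e = trans (cong (λ b → L a ∧ not b) e) (∧-identityʳ (L a))

∖-at : (L : Fin n → Bool) (i : Fin n) → (L ∖ i) i ≡ false
∖-at L i = trans (cong (λ b → L i ∧ not b) (==-refl i)) (∧-zeroʳ (L i))

-- A word of t letters (j v) has leaf set L exactly when its first leaf i lies in L and the
-- remaining t-1 leaves form either L or L without i.
hasElems-∷ : (L : Fin n → Bool) (i : Fin n) (s : List (Fin n)) (X : ℕ) →
  when (hasElems L (i ∷ s)) X ≡ when (L i) (when (hasElems L s) X + when (hasElems (L ∖ i) s) X)
hasElems-∷ L i s X with L i in Li | i ∈ᵇ s in i∈s
... | false | _ =
  cong (λ b → when b X) (hasElems-false L (i ∷ s) i (λ e → true≢false (trans (sym (∈ᵇ-head i s)) (trans e Li))))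
... | true | true = begin
    when (hasElems L (i ∷ s)) X
  ≡⟨ cong (λ b → when b X) (hasElems-away i _ _ (i ∷ s) s (λ a e → cong (_∨ (a ∈ᵇ s)) e) (λ _ _ → refl)
                                           (trans (∈ᵇ-head i s) (sym Li)) (trans i∈s (sym Li))) ⟩
    when (hasElems L s) X
  ≡⟨ sym (+-identityʳ _) ⟩
    when (hasElems L s) X + 0
  ≡⟨ cong (λ b → when (hasElems L s) X + when b X)
          (sym (hasElems-false (L ∖ i) s i (λ e → true≢false (trans (sym i∈s) (trans e (∖-at L i)))))) ⟩
    when (hasElems L s) X + when (hasElems (L ∖ i) s) X ∎
  where open ≡-Reasoning
... | true | false = begin
    when (hasElems L (i ∷ s)) X
  ≡⟨ cong (λ b → when b X) (hasElems-away i _ _ (i ∷ s) s (λ a e → cong (_∨ (a ∈ᵇ s)) e) (λ a e → sym (∖-away L i a e))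
                                           (trans (∈ᵇ-head i s) (sym Li)) (trans i∈s (sym (∖-at L i)))) ⟩
    when (hasElems (L ∖ i) s) X
  ≡⟨ cong (λ b → when b X + when (hasElems (L ∖ i) s) X)
          (sym (hasElems-false L s i (λ e → true≢false (sym (trans (sym i∈s) (trans e Li)))))) ⟩
    when (hasElems L s) X + when (hasElems (L ∖ i) s) X ∎
  where open ≡-Reasoning

Spanning : Fin n → ℕ → FSum n
Spanning v t = Stars v (hasElems (below v)) t

Commute : FSum n → FSum n → Set
Commute X Y = X ⊛ Y ≋ Y ⊛ X

Commute-conj : (X : FSum n) (τ : Transp n) → Commute X ⟪ τ ⟫ →
               ∀ g → mult X g ≡ mult X (swapT τ ∘ g ∘ swapT τ)
Commute-conj X τ c g = sym (begin
    mult X (swapT τ ∘ g ∘ swapT τ)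
  ≡⟨ sym (mult-⊛⟪⟫ X τ (g ∘ swapT τ)) ⟩
    mult (X ⊛ ⟪ τ ⟫) (g ∘ swapT τ)
  ≡⟨ mult≡ c _ ⟩
    mult (⟪ τ ⟫ ⊛ X) (g ∘ swapT τ)
  ≡⟨ mult-⟪⟫⊛ τ X _ ⟩
    mult X (g ∘ swapT τ ∘ swapT τ)
  ≡⟨ mult-cong X _ _ (λ x → cong g (swapT-involutive τ x)) ⟩
    mult X g ∎)
  where open ≡-Reasoning

⨁ : (Fin n → Bool) → (Fin n → FSum n) → FSum n
⨁ {n} L X = concatMap X (filter (T? ∘ L) (allFin n))

mult-⨁ : (L : Fin n → Bool) (X : Fin n → FSum n) (f : Fin n → Fin n) →
         mult (⨁ L X) f ≡ ∑ (allFin n) (λ i → when (L i) (mult (X i) f))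
mult-⨁ {n} L X f = trans (∑-concatMap X (filter (T? ∘ L) (allFin n)) _) (∑-filter (T? ∘ L) (allFin n) _)

⨁-cong : (L : Fin n → Bool) {X Y : Fin n → FSum n} → (∀ i → L i ≡ true → X i ≋ Y i) → ⨁ L X ≋ ⨁ L Y
⨁-cong {n} L {X} {Y} e = mk≋ λ f →
  trans (mult-⨁ L X f) (trans (∑-cong (allFin n) (λ i → when-cong (L i) (λ Li → mult≡ (e i Li) f))) (sym (mult-⨁ L Y f)))

⨁-++ : (L : Fin n → Bool) (X Y : Fin n → FSum n) → ⨁ L (λ i → X i ++ Y i) ≋ ⨁ L X ++ ⨁ L Y
⨁-++ {n} L X Y = mk≋ λ f → begin
    mult (⨁ L (λ i → X i ++ Y i)) f
  ≡⟨ mult-⨁ L _ f ⟩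
    ∑ (allFin n) (λ i → when (L i) (mult (X i ++ Y i) f))
  ≡⟨ ∑-cong (allFin n) (λ i → trans (cong (when (L i)) (mult-++ (X i) (Y i) f)) (when-+ (L i) _ _)) ⟩
    ∑ (allFin n) (λ i → when (L i) (mult (X i) f) + when (L i) (mult (Y i) f))
  ≡⟨ ∑-+ (allFin n) _ _ ⟩
    ∑ (allFin n) (λ i → when (L i) (mult (X i) f)) + ∑ (allFin n) (λ i → when (L i) (mult (Y i) f))
  ≡⟨ sym (cong₂ _+_ (mult-⨁ L X f) (mult-⨁ L Y f)) ⟩
    mult (⨁ L X) f + mult (⨁ L Y) f
  ≡⟨ sym (mult-++ (⨁ L X) (⨁ L Y) f) ⟩
    mult (⨁ L X ++ ⨁ L Y) f ∎
  where open ≡-Reasoning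

J⊛≋⨁ : (v : Fin n) (X : FSum n) → J v ⊛ X ≋ ⨁ (below v) (λ i → ⟪ (i , v) ⟫ ⊛ X)
J⊛≋⨁ {n} v X = mk≋ λ f → begin
    mult (J v ⊛ X) f
  ≡⟨ mult-⊛ (J v) X f ⟩
    ∑ (J v) (λ u → ∑ X (λ w → δ (u ++ w) f))
  ≡⟨ ∑-J v _ ⟩
    ∑ (allFin n) (λ i → when (i <ᵇ v) (∑ X (λ w → δ ((i , v) ∷ w) f)))
  ≡⟨ ∑-cong (allFin n) (λ i → cong (when (i <ᵇ v)) (sym (trans (mult-⊛ ⟪ (i , v) ⟫ X f) (+-identityʳ _)))) ⟩
    ∑ (allFin n) (λ i → when (i <ᵇ v) (mult (⟪ (i , v) ⟫ ⊛ X) f))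
  ≡⟨ sym (mult-⨁ (below v) _ f) ⟩
    mult (⨁ (below v) (λ i → ⟪ (i , v) ⟫ ⊛ X)) f ∎
  where open ≡-Reasoning

⊛J≋⨁ : (v : Fin n) (X : FSum n) → X ⊛ J v ≋ ⨁ (below v) (λ i → X ⊛ ⟪ (i , v) ⟫)
⊛J≋⨁ {n} v X = mk≋ λ f → begin
    mult (X ⊛ J v) f
  ≡⟨ mult-⊛ X (J v) f ⟩
    ∑ X (λ w → ∑ (J v) (λ u → δ (w ++ u) f))
  ≡⟨ ∑-cong X (λ w → ∑-J v _) ⟩
    ∑ X (λ w → ∑ (allFin n) (λ i → when (i <ᵇ v) (δ (w ++ (i , v) ∷ []) f)))
  ≡⟨ ∑-comm X (allFin n) _ ⟩
    ∑ (allFin n) (λ i → ∑ X (λ w → when (i <ᵇ v) (δ (w ++ (i , v) ∷ []) f)))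
  ≡⟨ ∑-cong (allFin n) (λ i → ∑-when X (i <ᵇ v) _) ⟩
    ∑ (allFin n) (λ i → when (i <ᵇ v) (∑ X (λ w → δ (w ++ (i , v) ∷ []) f)))
  ≡⟨ ∑-cong (allFin n) (λ i → cong (when (i <ᵇ v))
        (sym (trans (mult-⊛ X ⟪ (i , v) ⟫ f) (∑-cong X (λ w → +-identityʳ _))))) ⟩
    ∑ (allFin n) (λ i → when (i <ᵇ v) (mult (X ⊛ ⟪ (i , v) ⟫) f))
  ≡⟨ sym (mult-⨁ (below v) _ f) ⟩
    mult (⨁ (below v) (λ i → X ⊛ ⟪ (i , v) ⟫)) f ∎
  where open ≡-Reasoning

mult-⟪⟫⊛Stars : (i v : Fin n) (P : JMono n → Bool) (t : ℕ) (f : Fin n → Fin n) →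
  mult (⟪ (i , v) ⟫ ⊛ Stars v P t) f ≡ ∑ (seqs n t) (λ s → when (P s) (δ (star v (i ∷ s)) f))
mult-⟪⟫⊛Stars i v P t f = trans (mult-⊛ ⟪ (i , v) ⟫ (Stars v P t) f) (trans (+-identityʳ _) (∑-Stars v P t _))

Spanning-∷ : (v : Fin n) (t : ℕ) →
  Spanning v (suc t) ≋ ⨁ (below v) (λ i → ⟪ (i , v) ⟫ ⊛ (Spanning v t ++ Stars v (hasElems (below v ∖ i)) t))
Spanning-∷ {n} v t = mk≋ λ f → begin
    mult (Spanning v (suc t)) f
  ≡⟨ ∑-Stars v (hasElems L) (suc t) _ ⟩
    ∑ (seqs n (suc t)) (λ s → when (hasElems L s) (δ (star v s) f))
  ≡⟨ ∑-seqs-suc n t _ ⟩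
    ∑ (allFin n) (λ i → ∑ (seqs n t) (λ s → when (hasElems L (i ∷ s)) (D f i s)))
  ≡⟨ ∑-cong (allFin n) (λ i → ∑-cong (seqs n t) (λ s → hasElems-∷ L i s _)) ⟩
    ∑ (allFin n) (λ i → ∑ (seqs n t) (λ s → when (L i) (when (hasElems L s) (D f i s) + when (hasElems (L ∖ i) s) (D f i s))))
  ≡⟨ ∑-cong (allFin n) (λ i → trans (∑-when (seqs n t) (L i) _) (cong (when (L i)) (split f i))) ⟩
    ∑ (allFin n) (λ i → when (L i) (mult (⟪ (i , v) ⟫ ⊛ (Spanning v t ++ Stars v (hasElems (L ∖ i)) t)) f))
  ≡⟨ sym (mult-⨁ L _ f) ⟩
    mult (⨁ L (λ i → ⟪ (i , v) ⟫ ⊛ (Spanning v t ++ Stars v (hasElems (L ∖ i)) t))) f ∎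
  where
  open ≡-Reasoning
  L = below v
  D : (Fin n → Fin n) → Fin n → JMono n → ℕ
  D f i s = δ (star v (i ∷ s)) f
  split : ∀ f i → ∑ (seqs n t) (λ s → when (hasElems L s) (D f i s) + when (hasElems (L ∖ i) s) (D f i s))
                  ≡ mult (⟪ (i , v) ⟫ ⊛ (Spanning v t ++ Stars v (hasElems (L ∖ i)) t)) f
  split f i = begin
      ∑ (seqs n t) (λ s → when (hasElems L s) (D f i s) + when (hasElems (L ∖ i) s) (D f i s))
    ≡⟨ ∑-+ (seqs n t) _ _ ⟩
      ∑ (seqs n t) (λ s → when (hasElems L s) (D f i s)) + ∑ (seqs n t) (λ s → when (hasElems (L ∖ i) s) (D f i s))
    ≡⟨ sym (cong₂ _+_ (mult-⟪⟫⊛Stars i v (hasElems L) t f) (mult-⟪⟫⊛Stars i v (hasElems (L ∖ i)) t f)) ⟩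
      mult (⟪ (i , v) ⟫ ⊛ Spanning v t) f + mult (⟪ (i , v) ⟫ ⊛ Stars v (hasElems (L ∖ i)) t) f
    ≡⟨ sym (trans (mult≡ (⊛-distribˡ ⟪ (i , v) ⟫ (Spanning v t) (Stars v (hasElems (L ∖ i)) t)) f)
                  (mult-++ (⟪ (i , v) ⟫ ⊛ Spanning v t) (⟪ (i , v) ⟫ ⊛ Stars v (hasElems (L ∖ i)) t) f)) ⟩
      mult (⟪ (i , v) ⟫ ⊛ (Spanning v t ++ Stars v (hasElems (L ∖ i)) t)) f ∎

==-swapT : (τ : Transp n) (a b : Fin n) → (a == swapT τ b) ≡ (swapT τ a == b)
==-swapT τ a b = bool-ext _ _
  (λ e → dec-true (swapT τ a ≟ b) (trans (cong (swapT τ) (==⇒≡ a (swapT τ b) e)) (swapT-involutive τ b)))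
  (λ e → dec-true (a ≟ swapT τ b) (trans (sym (swapT-involutive τ a)) (cong (swapT τ) (==⇒≡ (swapT τ a) b e))))

∈ᵇ-map-swapT : (τ : Transp n) (a : Fin n) (s : List (Fin n)) → (a ∈ᵇ map (swapT τ) s) ≡ (swapT τ a ∈ᵇ s)
∈ᵇ-map-swapT τ a []      = refl
∈ᵇ-map-swapT τ a (b ∷ s) = cong₂ _∨_ (==-swapT τ a b) (∈ᵇ-map-swapT τ a s)

hasElems-map-swapT : (τ : Transp n) (L : Fin n → Bool) (s : List (Fin n)) →
                     hasElems L (map (swapT τ) s) ≡ hasElems (L ∘ swapT τ) s
hasElems-map-swapT τ L s = does-⇔ (mk⇔ to from) (hasElems? L (map (swapT τ) s)) (hasElems? (L ∘ swapT τ) s)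
  where
  σ = swapT τ
  to : HasElems L (map σ s) → HasElems (L ∘ σ) s
  to h a = trans (cong (_∈ᵇ s) (sym (swapT-involutive τ a))) (trans (sym (∈ᵇ-map-swapT τ (σ a) s)) (h (σ a)))
  from : HasElems (L ∘ σ) s → HasElems L (map σ s)
  from h b = trans (∈ᵇ-map-swapT τ b s) (trans (h (σ b)) (cong L (swapT-involutive τ b)))

hasElems-cong : (L L′ : Fin n → Bool) (s : List (Fin n)) → (∀ a → L a ≡ L′ a) → hasElems L s ≡ hasElems L′ s
hasElems-cong L L′ s e = does-⇔ (mk⇔ (λ h a → trans (h a) (e a)) (λ h a → trans (h a) (sym (e a)))) (hasElems? L s) (hasElems? L′ s)

_⋖_ : Fin n → Fin n → Set
u ⋖ v = toℕ v ≡ suc (toℕ u)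

⋖⇒< : {u v : Fin n} → u ⋖ v → u < v
⋖⇒< {u = u} u⋖v = subst (suc (toℕ u) ℕ.≤_) (sym u⋖v) ℕₚ.≤-refl

<ᵇ-irrefl : (a : Fin n) → (a <ᵇ a) ≡ false
<ᵇ-irrefl a = dec-false (a <? a) (ℕₚ.<-irrefl refl)

<ᵇ-⋖ : {u v : Fin n} (a : Fin n) → u ⋖ v → a ≢ u → (a <ᵇ u) ≡ (a <ᵇ v)
<ᵇ-⋖ {u = u} {v} a u⋖v a≢u = does-⇔ (mk⇔ to from) (a <? u) (a <? v)
  where
  to : a < u → a < v
  to a<u = subst (toℕ a ℕ.<_) (sym u⋖v) (ℕₚ.m<n⇒m<1+n a<u)
  from : a < v → a < u
  from a<v = ℕₚ.≤∧≢⇒< (ℕₚ.≤-pred (subst (toℕ a ℕ.<_) u⋖v a<v)) (a≢u ∘ toℕ-injective)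

-- Conjugating by (i v), resp. (i u), moves the centre of a star to i; the two leaf conditions then agree.
below-swap : (u v i : Fin n) → u ⋖ v → i ≤ u → ∀ a → below u (swapT (i , u) a) ≡ (below v ∖ i) (swapT (i , v) a)
below-swap u v i u⋖v i≤u a = cases (a ≟ i) (a ≟ u) (a ≟ v)
  where
  u<v = ⋖⇒< u⋖v
  L = below v ∖ i
  cases : Dec (a ≡ i) → Dec (a ≡ u) → Dec (a ≡ v) → below u (swapT (i , u) a) ≡ L (swapT (i , v) a)
  cases (yes refl) _ _ = begin
      below u (swapT (a , u) a)   ≡⟨ cong (below u) (swapT-fst a u) ⟩
      u <ᵇ u                      ≡⟨ <ᵇ-irrefl u ⟩
      false                       ≡⟨ sym (cong (_∧ not (v == a)) (<ᵇ-irrefl v)) ⟩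
      L v                         ≡⟨ cong L (sym (swapT-fst a v)) ⟩
      L (swapT (a , v) a)         ∎
    where open ≡-Reasoning
  cases (no a≢i) (yes refl) _ = begin
      below a (swapT (i , a) a)   ≡⟨ cong (below a) (swapT-snd i a) ⟩
      i <ᵇ a                      ≡⟨ dec-true (i <? a) (ℕₚ.≤∧≢⇒< i≤u (a≢i ∘ sym ∘ toℕ-injective)) ⟩
      true                        ≡⟨ sym (dec-true (a <? v) u<v) ⟩
      a <ᵇ v                      ≡⟨ sym (∖-away (below v) i a (≢⇒==-false a i a≢i)) ⟩
      L a                         ≡⟨ cong L (sym (swapT-other i v a a≢i (λ a≡v → ℕₚ.<-irrefl (cong toℕ a≡v) u<v))) ⟩
      L (swapT (i , v) a)         ∎
    where open ≡-Reasoning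
  cases (no a≢i) (no a≢u) (yes refl) = begin
      below u (swapT (i , u) a)   ≡⟨ cong (below u) (swapT-other i u a a≢i a≢u) ⟩
      a <ᵇ u                      ≡⟨ dec-false (a <? u) (ℕₚ.<-asym u<v) ⟩
      false                       ≡⟨ sym (∖-at (below a) i) ⟩
      L i                         ≡⟨ cong L (sym (swapT-snd i a)) ⟩
      L (swapT (i , a) a)         ∎
    where open ≡-Reasoning
  cases (no a≢i) (no a≢u) (no a≢v) = begin
      below u (swapT (i , u) a)   ≡⟨ cong (below u) (swapT-other i u a a≢i a≢u) ⟩
      a <ᵇ u                      ≡⟨ <ᵇ-⋖ a u⋖v a≢u ⟩
      a <ᵇ v                      ≡⟨ sym (∖-away (below v) i a (≢⇒==-false a i a≢i)) ⟩
      L a                         ≡⟨ cong L (sym (swapT-other i v a a≢i a≢v)) ⟩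
      L (swapT (i , v) a)         ∎
    where open ≡-Reasoning

Central : Fin n → Set
Central u = ∀ t i → i ≤ u → Commute (Spanning u t) ⟪ (i , u) ⟫

-- Conjugating by (i v) turns the stars at v missing the leaf i into the spanning stars at i on
-- the points below v, and those are the spanning stars at u = v - 1 conjugated by (i u).
swap-missing-leaf : (u v : Fin n) → u ⋖ v → Central u → ∀ t i → (i <ᵇ v) ≡ true →
  ⟪ (i , v) ⟫ ⊛ Stars v (hasElems (below v ∖ i)) t ≋ Spanning u t ⊛ ⟪ (i , v) ⟫
swap-missing-leaf {n} u v u⋖v central t i i<v = mk≋ λ f → begin
    mult (⟪ (i , v) ⟫ ⊛ W) f
  ≡⟨ mult-⟪⟫⊛ (i , v) W f ⟩
    mult W (f ∘ σ)
  ≡⟨ mult-cong W _ _ (λ y → sym (swapT-involutive (i , v) (f (σ y)))) ⟩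
    mult W (σ ∘ (σ ∘ f) ∘ σ)
  ≡⟨ Stars-conj i v v (hasElems M) t (σ ∘ f) ⟩
    mult (Stars (σ v) (hasElems M ∘ map σ) t) (σ ∘ f)
  ≡⟨ cong (λ c → mult (Stars c (hasElems M ∘ map σ) t) (σ ∘ f)) (swapT-snd i v) ⟩
    mult (Stars i (hasElems M ∘ map σ) t) (σ ∘ f)
  ≡⟨ mult≡ (Stars-cong i _ _ t same-leaves) (σ ∘ f) ⟩
    mult (Stars i (hasElems (below u) ∘ map ρ) t) (σ ∘ f)
  ≡⟨ cong (λ c → mult (Stars c (hasElems (below u) ∘ map ρ) t) (σ ∘ f)) (sym (swapT-snd i u)) ⟩
    mult (Stars (ρ u) (hasElems (below u) ∘ map ρ) t) (σ ∘ f)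
  ≡⟨ sym (Stars-conj i u u (hasElems (below u)) t (σ ∘ f)) ⟩
    mult (Spanning u t) (ρ ∘ (σ ∘ f) ∘ ρ)
  ≡⟨ sym (Commute-conj (Spanning u t) (i , u) (central t i i≤u) (σ ∘ f)) ⟩
    mult (Spanning u t) (σ ∘ f)
  ≡⟨ sym (mult-⊛⟪⟫ (Spanning u t) (i , v) f) ⟩
    mult (Spanning u t ⊛ ⟪ (i , v) ⟫) f ∎
  where
  open ≡-Reasoning
  M = below v ∖ i
  W = Stars v (hasElems M) t
  σ = swapT (i , v)
  ρ = swapT (i , u)
  i≤u : i ≤ u
  i≤u = ℕₚ.≤-pred (subst (toℕ i ℕ.<_) u⋖v (true⇒ (i <? v) i<v))
  same-leaves : ∀ s → hasElems M (map σ s) ≡ hasElems (below u) (map ρ s)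
  same-leaves s = begin
    hasElems M (map σ s)           ≡⟨ hasElems-map-swapT (i , v) M s ⟩
    hasElems (M ∘ σ) s             ≡⟨ hasElems-cong _ _ s (λ a → sym (below-swap u v i u⋖v i≤u a)) ⟩
    hasElems (below u ∘ ρ) s       ≡⟨ sym (hasElems-map-swapT (i , u) (below u) s) ⟩
    hasElems (below u) (map ρ s)   ∎

Spanning-rec : (u v : Fin n) → u ⋖ v → Central u → ∀ t →
               Spanning v (suc t) ≋ J v ⊛ Spanning v t ++ Spanning u t ⊛ J v
Spanning-rec {n} u v u⋖v central t = begin
    Spanning v (suc t)
  ≈⟨ Spanning-∷ v t ⟩
    ⨁ L (λ i → ⟪ (i , v) ⟫ ⊛ (Spanning v t ++ Missing i))
  ≈⟨ ⨁-cong L (λ i _ → ⊛-distribˡ ⟪ (i , v) ⟫ (Spanning v t) (Missing i)) ⟩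
    ⨁ L (λ i → ⟪ (i , v) ⟫ ⊛ Spanning v t ++ ⟪ (i , v) ⟫ ⊛ Missing i)
  ≈⟨ ⨁-++ L _ _ ⟩
    ⨁ L (λ i → ⟪ (i , v) ⟫ ⊛ Spanning v t) ++ ⨁ L (λ i → ⟪ (i , v) ⟫ ⊛ Missing i)
  ≈⟨ ++-cong (≋-sym (J⊛≋⨁ v (Spanning v t))) (⨁-cong L (swap-missing-leaf u v u⋖v central t)) ⟩
    J v ⊛ Spanning v t ++ ⨁ L (λ i → Spanning u t ⊛ ⟪ (i , v) ⟫)
  ≈⟨ ++-congʳ (J v ⊛ Spanning v t) (≋-sym (⊛J≋⨁ v (Spanning u t))) ⟩
    J v ⊛ Spanning v t ++ Spanning u t ⊛ J v ∎
  where
  open SetoidReasoning (≋-setoid n)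
  L = below v
  Missing : Fin n → FSum n
  Missing i = Stars v (hasElems (L ∖ i)) t

-- Centrality of the spanning star sums

Commute-sym : (X Y : FSum n) → Commute X Y → Commute Y X
Commute-sym X Y = ≋-sym

Commute-[] : {X : FSum n} (Y : FSum n) → X ≋ [] → Commute X Y
Commute-[] Y e = ≋-trans (⊛-congˡ Y e) (≋-sym (≋-trans (⊛-congʳ Y e) (⊛-zeroʳ Y)))

Commute-ε : (X : FSum n) {Y : FSum n} → Y ≋ ε → Commute X Y
Commute-ε X {Y} e = ≋-trans (⊛-congʳ X e) (≋-trans (⊛-identityʳ X) (≋-sym (≋-trans (⊛-congˡ X e) (⊛-identityˡ X))))

Commute-≋ˡ : {X X′ : FSum n} (Y : FSum n) → X ≋ X′ → Commute X′ Y → Commute X Y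
Commute-≋ˡ Y e c = ≋-trans (⊛-congˡ Y e) (≋-trans c (⊛-congʳ Y (≋-sym e)))

Commute-≋ʳ : (X : FSum n) {Y Y′ : FSum n} → Y ≋ Y′ → Commute X Y′ → Commute X Y
Commute-≋ʳ X e c = ≋-trans (⊛-congʳ X e) (≋-trans c (⊛-congˡ X (≋-sym e)))

Commute-++ˡ : (A B Y : FSum n) → Commute A Y → Commute B Y → Commute (A ++ B) Y
Commute-++ˡ A B Y ca cb = ≋-trans (⊛-distribʳ A B Y) (≋-trans (++-cong ca cb) (≋-sym (⊛-distribˡ Y A B)))

Commute-⊛ˡ : (A B Y : FSum n) → Commute A Y → Commute B Y → Commute (A ⊛ B) Y
Commute-⊛ˡ {n} A B Y ca cb = begin
    (A ⊛ B) ⊛ Y ≈⟨ ⊛-assoc A B Y ⟩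
    A ⊛ (B ⊛ Y) ≈⟨ ⊛-congʳ A cb ⟩
    A ⊛ (Y ⊛ B) ≈⟨ ≋-sym (⊛-assoc A Y B) ⟩
    (A ⊛ Y) ⊛ B ≈⟨ ⊛-congˡ B ca ⟩
    (Y ⊛ A) ⊛ B ≈⟨ ⊛-assoc Y A B ⟩
    Y ⊛ (A ⊛ B) ∎
  where open SetoidReasoning (≋-setoid n)

Commute-⊛ʳ : (X A B : FSum n) → Commute X A → Commute X B → Commute X (A ⊛ B)
Commute-⊛ʳ X A B ca cb = Commute-sym (A ⊛ B) X (Commute-⊛ˡ A B X (Commute-sym X A ca) (Commute-sym X B cb))

≋-words : (u w : Word n) → (∀ x → act u x ≡ act w x) → u ∷ [] ≋ w ∷ []
≋-words u w e = mk≋ λ f → cong (_+ 0) (δ-word u w f e)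

J-zero : ∀ {m} → J {suc m} zero ≋ []
J-zero {m} = mk≋ λ f → trans (∑-J zero (λ w → δ w f)) (∑-zero (allFin (suc m)))

Spanning-zero-0 : ∀ {m} → Spanning {suc m} zero 0 ≋ ε
Spanning-zero-0 {m} = mk≋ λ f →
  trans (∑-Stars zero (hasElems (below zero)) 0 (λ w → δ w f)) (cong (λ b → when b (δ [] f) + 0) nothing-below)
  where
  nothing-below : hasElems (below {suc m} zero) [] ≡ true
  nothing-below = dec-true (hasElems? (below {suc m} zero) []) (λ a → sym (dec-false (a <? zero {n = m}) λ ()))

Spanning-zero-suc : ∀ {m} t → Spanning {suc m} zero (suc t) ≋ []
Spanning-zero-suc {m} t = ≋-trans (Spanning-∷ zero t) (mk≋ λ f →
  trans (mult-⨁ (below zero) (λ i → ⟪ (i , zero) ⟫ ⊛ (Spanning zero t ++ Stars zero (hasElems (below zero ∖ i)) t)) f)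
        (∑-zero (allFin (suc m))))

Spanning-zero-commutes : ∀ {m} t (Y : FSum (suc m)) → Commute (Spanning zero t) Y
Spanning-zero-commutes zero    Y = Commute-sym Y (Spanning zero 0) (Commute-ε Y Spanning-zero-0)
Spanning-zero-commutes (suc t) Y = Commute-[] Y (Spanning-zero-suc t)

Spanning-⋖-0 : {u v : Fin n} → u ⋖ v → Spanning v 0 ≋ []
Spanning-⋖-0 {suc m} {u} {v} u⋖v = mk≋ λ f → trans (∑-Stars v (hasElems (below v)) 0 (λ w → δ w f)) (
  cong (λ b → when b (δ [] f) + 0) (hasElems-false (below v) [] zero (λ e → true≢false (sym (trans e zero<v)))))
  where
  zero<v : (zero <ᵇ v) ≡ true
  zero<v = dec-true (zero {n = m} <? v) (subst (1 ℕ.≤_) (sym u⋖v) (ℕ.s≤s ℕ.z≤n))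

⨁-split : (L L′ : Fin n → Bool) (a : Fin n) → (∀ i → L i ≡ L′ i ∨ (i == a)) → L′ a ≡ false →
          (X : Fin n → FSum n) → ⨁ L X ≋ ⨁ L′ X ++ X a
⨁-split {n} L L′ a L≡L′∨a L′a X = mk≋ λ f → begin
    mult (⨁ L X) f
  ≡⟨ mult-⨁ L X f ⟩
    ∑ (allFin n) (λ i → when (L i) (mult (X i) f))
  ≡⟨ ∑-cong (allFin n) (λ i → trans (cong (λ b → when b (mult (X i) f)) (L≡L′∨a i)) (when-∨ (L′ i) (i == a) _ (disjoint i))) ⟩
    ∑ (allFin n) (λ i → when (L′ i) (mult (X i) f) + when (i == a) (mult (X i) f))
  ≡⟨ ∑-+ (allFin n) _ _ ⟩
    ∑ (allFin n) (λ i → when (L′ i) (mult (X i) f)) + ∑ (allFin n) (λ i → when (i == a) (mult (X i) f))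
  ≡⟨ cong₂ _+_ (sym (mult-⨁ L′ X f)) (∑-δ n a (λ i → mult (X i) f)) ⟩
    mult (⨁ L′ X) f + mult (X a) f
  ≡⟨ sym (mult-++ (⨁ L′ X) (X a) f) ⟩
    mult (⨁ L′ X ++ X a) f ∎
  where
  open ≡-Reasoning
  disjoint : ∀ i → L′ i ≡ true → (i == a) ≡ false
  disjoint i L′i = ≢⇒==-false i a (λ { refl → true≢false (trans (sym L′i) L′a) })

below-⋖ : {u v : Fin n} → u ⋖ v → ∀ i → (i <ᵇ v) ≡ (i <ᵇ u) ∨ (i == u)
below-⋖ {u = u} {v} u⋖v i = does-⇔ (mk⇔ to from) (i <? v) ((i <? u) ⊎-dec (i ≟ u))
  where
  to : i < v → i < u ⊎ i ≡ u
  to i<v with ℕₚ.m≤n⇒m<n∨m≡n (ℕₚ.≤-pred (subst (toℕ i ℕ.<_) u⋖v i<v))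
  ... | inj₁ i<u = inj₁ i<u
  ... | inj₂ i≡u = inj₂ (toℕ-injective i≡u)
  from : i < u ⊎ i ≡ u → i < v
  from (inj₁ i<u) = ℕₚ.<-trans i<u (⋖⇒< u⋖v)
  from (inj₂ refl) = ⋖⇒< u⋖v

⟪⟫⊛⟪⟫-involutive : (τ : Transp n) → ε ≋ ⟪ τ ⟫ ⊛ ⟪ τ ⟫
⟪⟫⊛⟪⟫-involutive τ = ≋-words [] (τ ∷ τ ∷ []) (λ x → sym (swapT-involutive τ x))

module _ {u v : Fin n} (u⋖v : u ⋖ v) where

  private
    τ = (u , v)
    u<v = ⋖⇒< u⋖v

    slide : ∀ {j x} → j < u → swapT τ (swapT (j , v) x) ≡ swapT (j , u) (swapT τ x)
    slide {j} {x} j<u = trans (swapT-conj (swapT τ) (swapT-injective τ) j v x)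
      (cong₂ (λ a b → swapT (a , b) (swapT τ x))
             (swapT-other u v j (λ { refl → ℕₚ.<-irrefl refl j<u }) (λ { refl → ℕₚ.<-asym j<u u<v }))
             (swapT-snd u v))

    slide′ : ∀ {j x} → j < u → swapT τ (swapT (j , u) x) ≡ swapT (j , v) (swapT τ x)
    slide′ {j} {x} j<u = trans (swapT-conj (swapT τ) (swapT-injective τ) j u x)
      (cong₂ (λ a b → swapT (a , b) (swapT τ x))
             (swapT-other u v j (λ { refl → ℕₚ.<-irrefl refl j<u }) (λ { refl → ℕₚ.<-asym j<u u<v }))
             (swapT-fst u v))

  ⟪⟫J-relation : ⟪ τ ⟫ ⊛ J u ++ ε ≋ J v ⊛ ⟪ τ ⟫
  ⟪⟫J-relation = begin
      ⟪ τ ⟫ ⊛ J u ++ ε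
    ≈⟨ ++-cong (⊛J≋⨁ u ⟪ τ ⟫) (⟪⟫⊛⟪⟫-involutive τ) ⟩
      ⨁ (below u) (λ j → ⟪ τ ⟫ ⊛ ⟪ (j , u) ⟫) ++ ⟪ τ ⟫ ⊛ ⟪ τ ⟫
    ≈⟨ ++-congˡ (⟪ τ ⟫ ⊛ ⟪ τ ⟫) (⨁-cong (below u) (λ j j<u → ≋-words _ _ (λ x → sym (slide {x = x} (true⇒ (j <? u) j<u))))) ⟩
      ⨁ (below u) (λ j → ⟪ (j , v) ⟫ ⊛ ⟪ τ ⟫) ++ ⟪ τ ⟫ ⊛ ⟪ τ ⟫
    ≈⟨ ≋-sym (⨁-split (below v) (below u) u (below-⋖ u⋖v) (<ᵇ-irrefl u) (λ j → ⟪ (j , v) ⟫ ⊛ ⟪ τ ⟫)) ⟩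
      ⨁ (below v) (λ j → ⟪ (j , v) ⟫ ⊛ ⟪ τ ⟫)
    ≈⟨ ≋-sym (J⊛≋⨁ v ⟪ τ ⟫) ⟩
      J v ⊛ ⟪ τ ⟫ ∎
    where open SetoidReasoning (≋-setoid n)

  J⟪⟫-relation : J u ⊛ ⟪ τ ⟫ ++ ε ≋ ⟪ τ ⟫ ⊛ J v
  J⟪⟫-relation = begin
      J u ⊛ ⟪ τ ⟫ ++ ε
    ≈⟨ ++-cong (J⊛≋⨁ u ⟪ τ ⟫) (⟪⟫⊛⟪⟫-involutive τ) ⟩
      ⨁ (below u) (λ j → ⟪ (j , u) ⟫ ⊛ ⟪ τ ⟫) ++ ⟪ τ ⟫ ⊛ ⟪ τ ⟫
    ≈⟨ ++-congˡ (⟪ τ ⟫ ⊛ ⟪ τ ⟫) (⨁-cong (below u) (λ j j<u → ≋-words _ _ (λ x → slide′ {x = x} (true⇒ (j <? u) j<u)))) ⟩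
      ⨁ (below u) (λ j → ⟪ τ ⟫ ⊛ ⟪ (j , v) ⟫) ++ ⟪ τ ⟫ ⊛ ⟪ τ ⟫
    ≈⟨ ≋-sym (⨁-split (below v) (below u) u (below-⋖ u⋖v) (<ᵇ-irrefl u) (λ j → ⟪ τ ⟫ ⊛ ⟪ (j , v) ⟫)) ⟩
      ⨁ (below v) (λ j → ⟪ τ ⟫ ⊛ ⟪ (j , v) ⟫)
    ≈⟨ ≋-sym (⊛J≋⨁ v ⟪ τ ⟫) ⟩
      ⟪ τ ⟫ ⊛ J v ∎
    where open SetoidReasoning (≋-setoid n)

-- Eliminating V from the two recurrences gives U(t+2) + x y U(t) = (x + y) U(t+1) + x y W(t), and the
-- relations τ x + 1 = y τ and x τ + 1 = τ y make τ commute with x + y and with x y.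
module TranspositionCommutes {n : ℕ} (x y τ : FSum n) (U V W : ℕ → FSum n)
  (U-0 : U 0 ≋ []) (V-0 : V 0 ≋ [])
  (V-rec : ∀ s → V (suc s) ≋ x ⊛ V s ++ W s ⊛ x)
  (U-rec : ∀ t → U (suc t) ≋ y ⊛ U t ++ V t ⊛ y)
  (xy : Commute x y) (τx : τ ⊛ x ++ ε ≋ y ⊛ τ) (xτ : x ⊛ τ ++ ε ≋ τ ⊛ y)
  (Wx : ∀ s → Commute (W s) x) (Wy : ∀ s → Commute (W s) y) (Wτ : ∀ s → Commute (W s) τ) where

  open SetoidReasoning (≋-setoid n)

  private
    e₁ e₂ : FSum n
    e₁ = x ++ y
    e₂ = x ⊛ y

    τe₁ : Commute τ e₁
    τe₁ = ++-cancelʳ {C = ε} (begin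
        τ ⊛ e₁ ++ ε                 ≈⟨ ++-congˡ ε (⊛-distribˡ τ x y) ⟩
        (τ ⊛ x ++ τ ⊛ y) ++ ε       ≈⟨ ++-congˡ ε (++-comm≋ (τ ⊛ x) (τ ⊛ y)) ⟩
        (τ ⊛ y ++ τ ⊛ x) ++ ε       ≈⟨ ++-assoc≋ (τ ⊛ y) (τ ⊛ x) ε ⟩
        τ ⊛ y ++ (τ ⊛ x ++ ε)       ≈⟨ ++-congʳ (τ ⊛ y) τx ⟩
        τ ⊛ y ++ y ⊛ τ              ≈⟨ ++-congˡ (y ⊛ τ) (≋-sym xτ) ⟩
        (x ⊛ τ ++ ε) ++ y ⊛ τ       ≈⟨ ++-assoc≋ (x ⊛ τ) ε (y ⊛ τ) ⟩
        x ⊛ τ ++ (ε ++ y ⊛ τ)       ≈⟨ ++-congʳ (x ⊛ τ) (++-comm≋ ε (y ⊛ τ)) ⟩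
        x ⊛ τ ++ (y ⊛ τ ++ ε)       ≈⟨ ≋-sym (++-assoc≋ (x ⊛ τ) (y ⊛ τ) ε) ⟩
        (x ⊛ τ ++ y ⊛ τ) ++ ε       ≈⟨ ++-congˡ ε (≋-sym (⊛-distribʳ x y τ)) ⟩
        e₁ ⊛ τ ++ ε                 ∎)

    τe₂ : Commute τ e₂
    τe₂ = begin
        τ ⊛ (x ⊛ y)     ≈⟨ ≋-sym (⊛-assoc τ x y) ⟩
        (τ ⊛ x) ⊛ y     ≈⟨ τxy ⟩
        (y ⊛ x) ⊛ τ     ≈⟨ ⊛-congˡ τ (≋-sym xy) ⟩
        (x ⊛ y) ⊛ τ     ∎
      where
      τxy : (τ ⊛ x) ⊛ y ≋ (y ⊛ x) ⊛ τ
      τxy = ++-cancelʳ {C = y} (begin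
          (τ ⊛ x) ⊛ y ++ y          ≈⟨ ++-congʳ ((τ ⊛ x) ⊛ y) (≋-sym (⊛-identityˡ y)) ⟩
          (τ ⊛ x) ⊛ y ++ ε ⊛ y      ≈⟨ ≋-sym (⊛-distribʳ (τ ⊛ x) ε y) ⟩
          (τ ⊛ x ++ ε) ⊛ y          ≈⟨ ⊛-congˡ y τx ⟩
          (y ⊛ τ) ⊛ y               ≈⟨ ⊛-assoc y τ y ⟩
          y ⊛ (τ ⊛ y)               ≈⟨ ⊛-congʳ y (≋-sym xτ) ⟩
          y ⊛ (x ⊛ τ ++ ε)          ≈⟨ ⊛-distribˡ y (x ⊛ τ) ε ⟩
          y ⊛ (x ⊛ τ) ++ y ⊛ ε      ≈⟨ ++-cong (≋-sym (⊛-assoc y x τ)) (⊛-identityʳ y) ⟩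
          (y ⊛ x) ⊛ τ ++ y          ∎)

    ++-rearrange : (P Q R S : FSum n) → (P ++ (Q ++ R)) ++ S ≋ (P ++ (S ++ Q)) ++ R
    ++-rearrange P Q R S = begin
      (P ++ (Q ++ R)) ++ S    ≈⟨ ++-assoc≋ P (Q ++ R) S ⟩
      P ++ ((Q ++ R) ++ S)    ≈⟨ ++-congʳ P (++-comm≋ (Q ++ R) S) ⟩
      P ++ (S ++ (Q ++ R))    ≈⟨ ++-congʳ P (≋-sym (++-assoc≋ S Q R)) ⟩
      P ++ ((S ++ Q) ++ R)    ≈⟨ ≋-sym (++-assoc≋ P (S ++ Q) R) ⟩
      (P ++ (S ++ Q)) ++ R    ∎

    U-rec₂ : ∀ t → U (suc (suc t)) ++ e₂ ⊛ U t ≋ e₁ ⊛ U (suc t) ++ e₂ ⊛ W t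
    U-rec₂ t = begin
        U (suc (suc t)) ++ e₂ ⊛ U t
      ≈⟨ ++-cong (U-rec (suc t)) (⊛-assoc x y (U t)) ⟩
        (y ⊛ U (suc t) ++ V (suc t) ⊛ y) ++ x ⊛ (y ⊛ U t)
      ≈⟨ ++-congˡ (x ⊛ (y ⊛ U t)) (++-congʳ (y ⊛ U (suc t)) (≋-trans (⊛-congˡ y (V-rec t))
           (≋-trans (⊛-distribʳ (x ⊛ V t) (W t ⊛ x) y) (++-cong (⊛-assoc x (V t) y) (⊛-assoc (W t) x y))))) ⟩
        (y ⊛ U (suc t) ++ (x ⊛ (V t ⊛ y) ++ W t ⊛ e₂)) ++ x ⊛ (y ⊛ U t)
      ≈⟨ ++-rearrange (y ⊛ U (suc t)) (x ⊛ (V t ⊛ y)) (W t ⊛ e₂) (x ⊛ (y ⊛ U t)) ⟩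
        (y ⊛ U (suc t) ++ (x ⊛ (y ⊛ U t) ++ x ⊛ (V t ⊛ y))) ++ W t ⊛ e₂
      ≈⟨ ++-cong (++-congʳ (y ⊛ U (suc t)) (≋-trans (≋-sym (⊛-distribˡ x (y ⊛ U t) (V t ⊛ y))) (⊛-congʳ x (≋-sym (U-rec t)))))
                 (Commute-⊛ʳ (W t) x y (Wx t) (Wy t)) ⟩
        (y ⊛ U (suc t) ++ x ⊛ U (suc t)) ++ e₂ ⊛ W t
      ≈⟨ ++-congˡ (e₂ ⊛ W t) (≋-trans (++-comm≋ (y ⊛ U (suc t)) (x ⊛ U (suc t))) (≋-sym (⊛-distribʳ x y (U (suc t))))) ⟩
        e₁ ⊛ U (suc t) ++ e₂ ⊛ W t ∎

    U-1 : U 1 ≋ []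
    U-1 = ≋-trans (U-rec 0) (++-cong (≋-trans (⊛-congʳ y U-0) (⊛-zeroʳ y)) (⊛-congˡ y V-0))

    τU : ∀ t → Commute τ (U t) × Commute τ (U (suc t))
    τU zero    = Commute-sym (U 0) τ (Commute-[] τ U-0) , Commute-sym (U 1) τ (Commute-[] τ U-1)
    τU (suc t) with τU t
    ... | τU₀ , τU₁ = τU₁ , ++-cancelʳ {C = τ ⊛ (e₂ ⊛ U t)} (begin
        τ ⊛ U (suc (suc t)) ++ τ ⊛ (e₂ ⊛ U t)     ≈⟨ ≋-sym (⊛-distribˡ τ (U (suc (suc t))) (e₂ ⊛ U t)) ⟩
        τ ⊛ (U (suc (suc t)) ++ e₂ ⊛ U t)         ≈⟨ ⊛-congʳ τ (U-rec₂ t) ⟩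
        τ ⊛ (e₁ ⊛ U (suc t) ++ e₂ ⊛ W t)          ≈⟨ Commute-sym _ τ (Commute-++ˡ (e₁ ⊛ U (suc t)) (e₂ ⊛ W t) τ
                                                        (Commute-sym τ _ (Commute-⊛ʳ τ e₁ (U (suc t)) τe₁ τU₁))
                                                        (Commute-sym τ _ (Commute-⊛ʳ τ e₂ (W t) τe₂ (Commute-sym (W t) τ (Wτ t))))) ⟩
        (e₁ ⊛ U (suc t) ++ e₂ ⊛ W t) ⊛ τ          ≈⟨ ⊛-congˡ τ (≋-sym (U-rec₂ t)) ⟩
        (U (suc (suc t)) ++ e₂ ⊛ U t) ⊛ τ         ≈⟨ ⊛-distribʳ (U (suc (suc t))) (e₂ ⊛ U t) τ ⟩
        U (suc (suc t)) ⊛ τ ++ (e₂ ⊛ U t) ⊛ τ     ≈⟨ ++-congʳ (U (suc (suc t)) ⊛ τ) (≋-sym (Commute-⊛ʳ τ e₂ (U t) τe₂ τU₀)) ⟩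
        U (suc (suc t)) ⊛ τ ++ τ ⊛ (e₂ ⊛ U t)     ∎)

  U-commutes : ∀ t → Commute (U t) τ
  U-commutes t = Commute-sym τ (U t) (proj₁ (τU t))

Spanning-commutes : {u v : Fin n} → u ⋖ v → Central u → (Y : FSum n) →
  Commute (J v) Y → (∀ t → Commute (Spanning u t) Y) → ∀ t → Commute (Spanning v t) Y
Spanning-commutes u⋖v central-u Y JY SY zero    = Commute-[] Y (Spanning-⋖-0 u⋖v)
Spanning-commutes {u = u} {v} u⋖v central-u Y JY SY (suc t) =
  Commute-≋ˡ Y (Spanning-rec u v u⋖v central-u t)
    (Commute-++ˡ (J v ⊛ Spanning v t) (Spanning u t ⊛ J v) Y
      (Commute-⊛ˡ (J v) (Spanning v t) Y JY (Spanning-commutes u⋖v central-u Y JY SY t))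
      (Commute-⊛ˡ (Spanning u t) (J v) Y (SY t) JY))

Commute-⟪diag⟫ : (X : FSum n) (a : Fin n) → Commute X ⟪ (a , a) ⟫
Commute-⟪diag⟫ X a = Commute-ε X (≋-words ((a , a) ∷ []) [] (swapT-diag a))

-- Centrality under the transpositions (i v), i < u, follows from (i v) = (i u)(u v)(i u).
Central-⋖ : (u v : Fin n) → u ⋖ v → Central u → (∀ t → Commute (Spanning v t) ⟪ (u , v) ⟫) → Central v
Central-⋖ u v u⋖v central-u uv t i i≤v with ℕₚ.m≤n⇒m<n∨m≡n i≤v
... | inj₂ i≡v = subst (λ z → Commute (Spanning v t) ⟪ (z , v) ⟫) (sym (toℕ-injective i≡v)) (Commute-⟪diag⟫ (Spanning v t) v)
... | inj₁ i<v with ℕₚ.m≤n⇒m<n∨m≡n (ℕₚ.≤-pred (subst (toℕ i ℕ.<_) u⋖v i<v))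
...   | inj₂ i≡u = subst (λ z → Commute (Spanning v t) ⟪ (z , v) ⟫) (sym (toℕ-injective i≡u)) (uv t)
...   | inj₁ i<u =
  Commute-≋ʳ (Spanning v t) (≋-words ((i , v) ∷ []) ((i , u) ∷ (u , v) ∷ (i , u) ∷ []) conjugate)
    (Commute-⊛ʳ (Spanning v t) ⟪ (i , u) ⟫ (⟪ (u , v) ⟫ ⊛ ⟪ (i , u) ⟫) (iu t)
      (Commute-⊛ʳ (Spanning v t) ⟪ (u , v) ⟫ ⟪ (i , u) ⟫ (uv t) (iu t)))
  where
  u<v = ⋖⇒< u⋖v
  iu : ∀ t → Commute (Spanning v t) ⟪ (i , u) ⟫
  iu = Spanning-commutes u⋖v central-u ⟪ (i , u) ⟫
         (J-comm-below v ⟪ (i , u) ⟫ (SumBelow-⟪⟫ (ℕₚ.<-trans i<u u<v) u<v))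
         (λ t → central-u t i (ℕₚ.<⇒≤ i<u))
  conjugate : ∀ x → swapT (i , v) x ≡ swapT (i , u) (swapT (u , v) (swapT (i , u) x))
  conjugate x = sym (begin
      swapT (i , u) (swapT (u , v) (swapT (i , u) x))
    ≡⟨ swapT-conj (swapT (i , u)) (swapT-injective (i , u)) u v (swapT (i , u) x) ⟩
      swapT (swapT (i , u) u , swapT (i , u) v) (swapT (i , u) (swapT (i , u) x))
    ≡⟨ cong₂ (λ p q → swapT p q) (cong₂ _,_ (swapT-snd i u) v-fixed) (swapT-involutive (i , u) x) ⟩
      swapT (i , v) x ∎)
    where
    open ≡-Reasoning
    v-fixed : swapT (i , u) v ≡ v
    v-fixed = swapT-other i u v (λ v≡i → ℕₚ.<-irrefl (cong toℕ (sym v≡i)) i<v)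
                                (λ v≡u → ℕₚ.<-irrefl (cong toℕ (sym v≡u)) u<v)

SumBelow-Spanning : {v c : Fin n} → v < c → ∀ t → SumBelow c (Spanning v t)
SumBelow-Spanning {n} {v} {c} v<c t =
  All.map⁺ (All.map (λ {s} spans → All.map⁺ (All.map (leaf s (Equivalence.to T-≡ spans)) (∈ᵇ-self s)))
                    (all-filter (T? ∘ hasElems (below v)) (seqs n t)))
  where
  leaf : ∀ s → hasElems (below v) s ≡ true → ∀ {a} → (a ∈ᵇ s) ≡ true → a < c × v < c
  leaf s spans {a} a∈s = ℕₚ.<-trans (true⇒ (a <? v) (trans (sym (true⇒ (hasElems? (below v) s) spans a)) a∈s)) v<c , v<c

central-zero : (v : Fin n) → toℕ v ≡ 0 → Central v
central-zero v v≡0 t i i≤v =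
  subst (λ z → Commute (Spanning v t) ⟪ (z , v) ⟫) (sym (toℕ-injective (trans (ℕₚ.n≤0⇒n≡0 (subst (toℕ i ℕ.≤_) v≡0 i≤v)) (sym v≡0))))
        (Commute-⟪diag⟫ (Spanning v t) v)

central-one : (u v : Fin n) → u ⋖ v → toℕ u ≡ 0 → Central v
central-one {n} zero v u⋖v _ =
  Central-⋖ zero v u⋖v central-u
    (Spanning-commutes u⋖v central-u τ Jτ (λ t → Spanning-zero-commutes t τ))
  where
  τ = ⟪ (zero , v) ⟫
  central-u = central-zero zero refl
  Jτ : Commute (J v) τ
  Jτ = begin
      J v ⊛ τ          ≈⟨ ≋-sym (⟪⟫J-relation u⋖v) ⟩
      τ ⊛ J zero ++ ε  ≈⟨ ++-congˡ ε (≋-trans (⊛-congʳ τ J-zero) (⊛-zeroʳ τ)) ⟩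
      [] ++ ε          ≈⟨ ++-congˡ ε (≋-sym (⊛-congˡ τ J-zero)) ⟩
      J zero ⊛ τ ++ ε  ≈⟨ J⟪⟫-relation u⋖v ⟩
      τ ⊛ J v          ∎
    where open SetoidReasoning (≋-setoid n)

central-step : (w u v : Fin n) → w ⋖ u → u ⋖ v → Central w → Central u → Central v
central-step w u v w⋖u u⋖v central-w central-u =
  Central-⋖ u v u⋖v central-u
    (TranspositionCommutes.U-commutes (J u) (J v) ⟪ (u , v) ⟫ (Spanning v) (Spanning u) (Spanning w)
      (Spanning-⋖-0 u⋖v) (Spanning-⋖-0 w⋖u) (Spanning-rec w u w⋖u central-w) (Spanning-rec u v u⋖v central-u)
      (≋-sym (J-comm-below v (J u) (SumBelow-J u<v)))
      (⟪⟫J-relation u⋖v) (J⟪⟫-relation u⋖v)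
      (λ s → ≋-sym (J-comm-below u (Spanning w s) (SumBelow-Spanning w<u s)))
      (λ s → ≋-sym (J-comm-below v (Spanning w s) (SumBelow-Spanning (ℕₚ.<-trans w<u u<v) s)))
      (λ s → ≋-sym (⟪⟫-comm-below u u v (Spanning w s) (SumBelow-Spanning w<u s) (ℕₚ.<-irrefl refl) (ℕₚ.<-asym u<v))))
  where
  w<u = ⋖⇒< w⋖u
  u<v = ⋖⇒< u⋖v

predecessor : ∀ {c} (v : Fin n) → toℕ v ≡ suc c → Σ (Fin n) (λ u → u ⋖ v × toℕ u ≡ c)
predecessor (suc v) v≡1+c = inject₁ v , cong suc (sym (toℕ-inject₁ v)) , trans (toℕ-inject₁ v) (ℕₚ.suc-injective v≡1+c)

central-at : ∀ c → (∀ (v : Fin n) → toℕ v ≡ c → Central v) × (∀ (v : Fin n) → toℕ v ≡ suc c → Central v)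
central-at zero = central-zero , λ v v≡1 → let (u , u⋖v , u≡0) = predecessor v v≡1 in central-one u v u⋖v u≡0
central-at (suc c) with central-at c
... | central-c , central-1+c = central-1+c , λ v v≡2+c →
  let (u , u⋖v , u≡1+c) = predecessor v v≡2+c
      (w , w⋖u , w≡c)   = predecessor u u≡1+c
  in central-step w u v w⋖u u⋖v (central-c w w≡c) (central-1+c u u≡1+c)

central : (v : Fin n) → Central v
central v = proj₁ (central-at (toℕ v)) v refl

J-comm : (a b : Fin n) → Commute (J a) (J b)
J-comm a b with ℕₚ.<-cmp (toℕ a) (toℕ b)
... | tri< a<b _ _ = ≋-sym (J-comm-below b (J a) (SumBelow-J a<b))
... | tri≈ _ a≡b _ rewrite toℕ-injective a≡b = ≋-refl
... | tri> _ _ b<a = J-comm-below a (J b) (SumBelow-J b<a)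

expandMono-∷ : (x : Fin n) (xs : JMono n) → expandMono (x ∷ xs) ≋ J x ⊛ expandMono xs
expandMono-∷ x xs = expandMono-++ (x ∷ []) xs

expandMono-↭ : {xs ys : JMono n} → xs ↭ ys → expandMono xs ≋ expandMono ys
expandMono-↭ ↭-refl = ≋-refl
expandMono-↭ (↭-prep {xs = xs} {ys} x p) =
  ≋-trans (expandMono-∷ x xs) (≋-trans (⊛-congʳ (J x) (expandMono-↭ p)) (≋-sym (expandMono-∷ x ys)))
expandMono-↭ {n} (↭-swap {xs = xs} {ys} x y p) = begin
    expandMono (x ∷ y ∷ xs)            ≈⟨ expandMono-∷ x (y ∷ xs) ⟩
    J x ⊛ expandMono (y ∷ xs)          ≈⟨ ⊛-congʳ (J x) (expandMono-∷ y xs) ⟩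
    J x ⊛ (J y ⊛ expandMono xs)        ≈⟨ ≋-sym (⊛-assoc (J x) (J y) _) ⟩
    (J x ⊛ J y) ⊛ expandMono xs        ≈⟨ ⊛-cong (J-comm x y) (expandMono-↭ p) ⟩
    (J y ⊛ J x) ⊛ expandMono ys        ≈⟨ ⊛-assoc (J y) (J x) _ ⟩
    J y ⊛ (J x ⊛ expandMono ys)        ≈⟨ ⊛-congʳ (J y) (≋-sym (expandMono-∷ x ys)) ⟩
    J y ⊛ expandMono (x ∷ ys)          ≈⟨ ≋-sym (expandMono-∷ y (x ∷ ys)) ⟩
    expandMono (y ∷ x ∷ ys)            ∎
  where open SetoidReasoning (≋-setoid n)
expandMono-↭ (↭-trans p q) = ≋-trans (expandMono-↭ p) (expandMono-↭ q)

filter-↭-++ : {P Q R : A → Set} (P? : Decidable P) (Q? : Decidable Q) (R? : Decidable R) →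
  (∀ x → P x ⇔ (Q x ⊎ R x)) → (∀ x → Q x → ¬ R x) → ∀ xs → filter P? xs ↭ filter Q? xs ++ filter R? xs
filter-↭-++ P? Q? R? P⇔Q⊎R Q⇒¬R [] = ↭-refl
filter-↭-++ P? Q? R? P⇔Q⊎R Q⇒¬R (x ∷ xs) with P? x | Q? x | R? x
... | yes _ | yes _ | no _  = ↭-prep x (filter-↭-++ P? Q? R? P⇔Q⊎R Q⇒¬R xs)
... | yes _ | no _  | yes _ =
  ↭-trans (↭-prep x (filter-↭-++ P? Q? R? P⇔Q⊎R Q⇒¬R xs)) (↭-sym (shift x (filter Q? xs) (filter R? xs)))
... | no _  | no _  | no _  = filter-↭-++ P? Q? R? P⇔Q⊎R Q⇒¬R xs
... | _     | yes q | yes r = ⊥-elim (Q⇒¬R x q r)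
... | yes p | no ¬q | no ¬r = ⊥-elim ([ ¬q , ¬r ]′ (Equivalence.to (P⇔Q⊎R x) p))
... | no ¬p | yes q | _     = ⊥-elim (¬p (Equivalence.from (P⇔Q⊎R x) (inj₁ q)))
... | no ¬p | _     | yes r = ⊥-elim (¬p (Equivalence.from (P⇔Q⊎R x) (inj₂ r)))

filter-≟-tabulate : (f : Fin n → Fin n′) → (∀ {i j} → f i ≡ f j → i ≡ j) → (w : Fin n) →
                    filter (_≟ f w) (tabulate f) ≡ f w ∷ []
filter-≟-tabulate f f-inj zero    =
  trans (filter-accept (_≟ f zero) {xs = tabulate (f ∘ suc)} refl)
        (cong (f zero ∷_) (filter-none (_≟ f zero) {xs = tabulate (f ∘ suc)} (All.tabulate⁺ (λ i e → case f-inj e of λ ()))))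
filter-≟-tabulate f f-inj (suc w) =
  trans (filter-reject (_≟ f (suc w)) {xs = tabulate (f ∘ suc)} (λ e → case f-inj e of λ ()))
        (filter-≟-tabulate (f ∘ suc) (λ e → Fₚ.suc-injective (f-inj e)) w)

_≤ᵇ_ : Fin n → Fin n → Bool
a ≤ᵇ b = does (a ≤? b)

atMost : Fin n → Fin n → Bool
atMost v a = a ≤ᵇ v

≤-⋖ : {u v : Fin n} → u ⋖ v → ∀ i → i ≤ v ⇔ (i ≤ u ⊎ i ≡ v)
≤-⋖ {u = u} {v} u⋖v i = mk⇔ to from
  where
  to : i ≤ v → i ≤ u ⊎ i ≡ v
  to i≤v with ℕₚ.m≤n⇒m<n∨m≡n i≤v
  ... | inj₁ i<v = inj₁ (ℕₚ.≤-pred (subst (toℕ i ℕ.<_) u⋖v i<v))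
  ... | inj₂ i≡v = inj₂ (toℕ-injective i≡v)
  from : i ≤ u ⊎ i ≡ v → i ≤ v
  from (inj₁ i≤u) = ℕₚ.<⇒≤ (ℕₚ.≤-<-trans i≤u (⋖⇒< u⋖v))
  from (inj₂ refl) = ℕₚ.≤-refl

atMost-⋖ : {u v : Fin n} → u ⋖ v → ∀ i → (i ≤ᵇ v) ≡ (i ≤ᵇ u) ∨ (i == v)
atMost-⋖ {u = u} {v} u⋖v i = does-⇔ (≤-⋖ u⋖v i) (i ≤? v) ((i ≤? u) ⊎-dec (i ≟ v))

-- The indices of J₁ ⋯ J_v; the index 0 is dropped because J₀ = 0.
JProdIndices : Fin n → List (Fin n)
JProdIndices {n} v = filter (_≤? v) (drop 1 (allFin n))

JProd : Fin n → FSum n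
JProd v = expandMono (JProdIndices v)

JProd-rec : {u v : Fin n} → u ⋖ v → JProd v ≋ JProd u ⊛ J v
JProd-rec {suc m} {u} {suc w} u⋖v = ≋-trans (expandMono-↭ split) (expandMono-++ (JProdIndices u) (suc w ∷ []))
  where
  split : JProdIndices (suc w) ↭ JProdIndices u ++ suc w ∷ []
  split = subst (λ ws → JProdIndices (suc w) ↭ JProdIndices u ++ ws) (filter-≟-tabulate suc Fₚ.suc-injective w)
    (filter-↭-++ (_≤? suc w) (_≤? u) (_≟ suc w) (≤-⋖ u⋖v)
                 (λ i i≤u i≡v → ℕₚ.<-irrefl (cong toℕ i≡v) (ℕₚ.≤-<-trans i≤u (⋖⇒< u⋖v)))
                 (drop 1 (allFin (suc m))))

Linked-∷ʳ⁻ : (s : List (Fin n)) {j : Fin n} → Linked _≤_ (s ∷ʳ j) → Linked _≤_ s × All (_≤ j) s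
Linked-∷ʳ⁻ []          _             = [] , []
Linked-∷ʳ⁻ (a ∷ [])     (a≤j ∷ [-])   = [-] , a≤j ∷ []
Linked-∷ʳ⁻ (a ∷ b ∷ s) (a≤b ∷ rest) with Linked-∷ʳ⁻ (b ∷ s) rest
... | sorted , b≤j ∷ s≤j = a≤b ∷ sorted , ℕₚ.≤-trans a≤b b≤j ∷ b≤j ∷ s≤j

Linked-∷ʳ⁺ : (s : List (Fin n)) {j : Fin n} → Linked _≤_ s × All (_≤ j) s → Linked _≤_ (s ∷ʳ j)
Linked-∷ʳ⁺ []          _                        = [-]
Linked-∷ʳ⁺ (a ∷ [])     (_ , a≤j ∷ [])            = a≤j ∷ [-]
Linked-∷ʳ⁺ (a ∷ b ∷ s) (a≤b ∷ sorted , _ ∷ bs≤j) = a≤b ∷ Linked-∷ʳ⁺ (b ∷ s) (sorted , bs≤j)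

Sorted : Fin n → List (Fin n) → Set
Sorted v s = Linked _≤_ s × All (_≤ v) s

sorted? : (v : Fin n) (s : List (Fin n)) → Dec (Sorted v s)
sorted? v s = linked? _≤?_ s ×-dec All.all? (_≤? v) s

Sorted-∷ʳ : (v : Fin n) (s : List (Fin n)) (j : Fin n) → Sorted v (s ∷ʳ j) ⇔ (j ≤ v × Sorted j s)
Sorted-∷ʳ v s j = mk⇔ to from
  where
  to : Sorted v (s ∷ʳ j) → j ≤ v × Sorted j s
  to (sorted , s≤v) = proj₂ (All.∷ʳ⁻ s≤v) , Linked-∷ʳ⁻ s sorted
  from : j ≤ v × Sorted j s → Sorted v (s ∷ʳ j)
  from (j≤v , sorted , s≤j) =
    Linked-∷ʳ⁺ s (sorted , s≤j) , All.∷ʳ⁺ (All.map (λ a≤j → ℕₚ.≤-trans a≤j j≤v) s≤j) j≤v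

H : Fin n → ℕ → FSum n
H {n} v k = expand (filter (sorted? v) (seqs n k))

∑-seqs-∷ʳ : ∀ n k (G : JMono n → ℕ) → ∑ (seqs n (suc k)) G ≡ ∑ (seqs n k) (λ s → ∑ (allFin n) (λ j → G (s ∷ʳ j)))
∑-seqs-∷ʳ n zero    G = trans (∑-seqs-suc n 0 G) (trans (∑-cong (allFin n) (λ i → +-identityʳ _)) (sym (+-identityʳ _)))
∑-seqs-∷ʳ n (suc k) G = begin
    ∑ (seqs n (suc (suc k))) G
  ≡⟨ ∑-seqs-suc n (suc k) G ⟩
    ∑ (allFin n) (λ i → ∑ (seqs n (suc k)) (λ s → G (i ∷ s)))
  ≡⟨ ∑-cong (allFin n) (λ i → ∑-seqs-∷ʳ n k (λ s → G (i ∷ s))) ⟩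
    ∑ (allFin n) (λ i → ∑ (seqs n k) (λ s → ∑ (allFin n) (λ j → G (i ∷ s ∷ʳ j))))
  ≡⟨ sym (∑-seqs-suc n k _) ⟩
    ∑ (seqs n (suc k)) (λ s → ∑ (allFin n) (λ j → G (s ∷ʳ j))) ∎
  where open ≡-Reasoning

mult-concatMap-filter : {P : A → Set} (P? : Decidable P) (F : A → FSum n) (xs : List A) (f : Fin n → Fin n) →
  mult (concatMap F (filter P? xs)) f ≡ ∑ xs (λ x → when (does (P? x)) (mult (F x) f))
mult-concatMap-filter P? F xs f = trans (∑-concatMap F (filter P? xs) _) (∑-filter P? xs _)

⊛-concatMap : (X : FSum n) (F : A → FSum n) (xs : List A) → X ⊛ concatMap F xs ≋ concatMap (λ x → X ⊛ F x) xs
⊛-concatMap X F []       = ⊛-zeroʳ X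
⊛-concatMap X F (x ∷ xs) = ≋-trans (⊛-distribˡ X (F x) (concatMap F xs)) (++-congʳ (X ⊛ F x) (⊛-concatMap X F xs))

H-∷ʳ : (v : Fin n) (k : ℕ) → H v (suc k) ≋ ⨁ (atMost v) (λ j → J j ⊛ H j k)
H-∷ʳ {n} v k = mk≋ λ f → begin
    mult (H v (suc k)) f
  ≡⟨ mult-concatMap-filter (sorted? v) expandMono (seqs n (suc k)) f ⟩
    ∑ (seqs n (suc k)) (λ s → when (does (sorted? v s)) (mult (expandMono s) f))
  ≡⟨ ∑-seqs-∷ʳ n k _ ⟩
    ∑ (seqs n k) (λ s → ∑ (allFin n) (λ j → when (does (sorted? v (s ∷ʳ j))) (mult (expandMono (s ∷ʳ j)) f)))
  ≡⟨ ∑-cong (seqs n k) (λ s → ∑-cong (allFin n) (λ j → cong₂ when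
       (does-⇔ (Sorted-∷ʳ v s j) (sorted? v (s ∷ʳ j)) ((j ≤? v) ×-dec sorted? j s))
       (mult≡ (≋-trans (expandMono-↭ (↭-sym (∷↭∷ʳ j s))) (expandMono-∷ j s)) f))) ⟩
    ∑ (seqs n k) (λ s → ∑ (allFin n) (λ j → when ((j ≤ᵇ v) ∧ does (sorted? j s)) (mult (J j ⊛ expandMono s) f)))
  ≡⟨ ∑-comm (seqs n k) (allFin n) _ ⟩
    ∑ (allFin n) (λ j → ∑ (seqs n k) (λ s → when ((j ≤ᵇ v) ∧ does (sorted? j s)) (mult (J j ⊛ expandMono s) f)))
  ≡⟨ ∑-cong (allFin n) (λ j → trans (∑-cong (seqs n k) (λ s → when-∧ (j ≤ᵇ v) _ _)) (∑-when (seqs n k) (j ≤ᵇ v) _)) ⟩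
    ∑ (allFin n) (λ j → when (j ≤ᵇ v) (∑ (seqs n k) (λ s → when (does (sorted? j s)) (mult (J j ⊛ expandMono s) f))))
  ≡⟨ ∑-cong (allFin n) (λ j → cong (when (j ≤ᵇ v)) (sym (J⊛H j f))) ⟩
    ∑ (allFin n) (λ j → when (j ≤ᵇ v) (mult (J j ⊛ H j k) f))
  ≡⟨ sym (mult-⨁ (atMost v) _ f) ⟩
    mult (⨁ (atMost v) (λ j → J j ⊛ H j k)) f ∎
  where
  open ≡-Reasoning
  J⊛H : ∀ j f → mult (J j ⊛ H j k) f ≡ ∑ (seqs n k) (λ s → when (does (sorted? j s)) (mult (J j ⊛ expandMono s) f))
  J⊛H j f = trans (mult≡ (⊛-concatMap (J j) expandMono (filter (sorted? j) (seqs n k))) f)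
                (mult-concatMap-filter (sorted? j) (λ s → J j ⊛ expandMono s) (seqs n k) f)

H-rec : {u v : Fin n} → u ⋖ v → ∀ k → H v (suc k) ≋ J v ⊛ H v k ++ H u (suc k)
H-rec {n} {u} {v} u⋖v k = begin
    H v (suc k)                                       ≈⟨ H-∷ʳ v k ⟩
    ⨁ (atMost v) X                                    ≈⟨ ⨁-split (atMost v) (atMost u) v (atMost-⋖ u⋖v) v≰u X ⟩
    ⨁ (atMost u) X ++ J v ⊛ H v k                     ≈⟨ ++-congˡ (J v ⊛ H v k) (≋-sym (H-∷ʳ u k)) ⟩
    H u (suc k) ++ J v ⊛ H v k                        ≈⟨ ++-comm≋ (H u (suc k)) (J v ⊛ H v k) ⟩
    J v ⊛ H v k ++ H u (suc k)                        ∎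
  where
  open SetoidReasoning (≋-setoid n)
  X = λ j → J j ⊛ H j k
  v≰u : (v ≤ᵇ u) ≡ false
  v≰u = dec-false (v ≤? u) (ℕₚ.<⇒≱ (⋖⇒< u⋖v))

H-zero-suc : ∀ {m} k → H {suc m} zero (suc k) ≋ []
H-zero-suc {m} k = begin
    H zero (suc k)                                    ≈⟨ H-∷ʳ zero k ⟩
    ⨁ (atMost zero) X                                 ≈⟨ ⨁-split (atMost zero) (λ _ → false) zero at-zero refl X ⟩
    ⨁ (λ _ → false) X ++ J zero ⊛ H zero k            ≈⟨ ++-cong (mk≋ λ f → trans (mult-⨁ (λ _ → false) X f) (∑-zero (allFin (suc m))))
                                                                 (⊛-congˡ (H zero k) J-zero) ⟩
    []                                                ∎
  where
  open SetoidReasoning (≋-setoid (suc m))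
  X = λ j → J j ⊛ H j k
  at-zero : ∀ i → (i ≤ᵇ zero) ≡ (i == zero)
  at-zero i = does-⇔ (mk⇔ (λ i≤0 → toℕ-injective (ℕₚ.n≤0⇒n≡0 i≤0)) (λ { refl → ℕₚ.≤-refl })) (i ≤? zero {n = m}) (i ≟ zero)

SumBelow-H : {v c : Fin n} → v < c → ∀ k → SumBelow c (H v k)
SumBelow-H {n} {v} {c} v<c k =
  All-concatMap expandMono (filter (sorted? v) (seqs n k))
    (All.map (λ {s} sorted → SumBelow-expandMono c s (All.map (λ a≤v → ℕₚ.≤-<-trans a≤v v<c) (proj₂ sorted)))
             (all-filter (sorted? v) (seqs n k)))

SumBelow-JProd : {v c : Fin n} → v < c → SumBelow c (JProd v)
SumBelow-JProd {n} {v} {c} v<c =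
  SumBelow-expandMono c (JProdIndices v) (All.map (λ a≤v → ℕₚ.≤-<-trans a≤v v<c) (all-filter (_≤? v) (drop 1 (allFin n))))

R : Fin n → ℕ → FSum n
R v k = JProd v ⊛ H v k

module _ {u v : Fin n} (u⋖v : u ⋖ v) where

  private
    u<v = ⋖⇒< u⋖v

    JProd-J : Commute (JProd v) (J v)
    JProd-J = Commute-≋ˡ (J v) (JProd-rec u⋖v)
      (Commute-⊛ˡ (JProd u) (J v) (J v) (≋-sym (J-comm-below v (JProd u) (SumBelow-JProd u<v))) ≋-refl)

  R-rec₀ : R v 0 ≋ R u 0 ⊛ J v
  R-rec₀ = begin
    JProd v ⊛ H v 0            ≈⟨ ⊛-identityʳ (JProd v) ⟩
    JProd v                    ≈⟨ JProd-rec u⋖v ⟩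
    JProd u ⊛ J v              ≈⟨ ⊛-congˡ (J v) (≋-sym (⊛-identityʳ (JProd u))) ⟩
    (JProd u ⊛ H u 0) ⊛ J v    ∎
    where open SetoidReasoning (≋-setoid n)

  R-rec : ∀ k → R v (suc k) ≋ J v ⊛ R v k ++ R u (suc k) ⊛ J v
  R-rec k = begin
      JProd v ⊛ H v (suc k)                             ≈⟨ ⊛-congʳ (JProd v) (H-rec u⋖v k) ⟩
      JProd v ⊛ (J v ⊛ H v k ++ H u (suc k))            ≈⟨ ⊛-distribˡ (JProd v) _ _ ⟩
      JProd v ⊛ (J v ⊛ H v k) ++ JProd v ⊛ H u (suc k)  ≈⟨ ++-cong first second ⟩
      J v ⊛ R v k ++ R u (suc k) ⊛ J v                  ∎
    where
    open SetoidReasoning (≋-setoid n)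
    first : JProd v ⊛ (J v ⊛ H v k) ≋ J v ⊛ R v k
    first = begin
      JProd v ⊛ (J v ⊛ H v k)      ≈⟨ ≋-sym (⊛-assoc (JProd v) (J v) (H v k)) ⟩
      (JProd v ⊛ J v) ⊛ H v k      ≈⟨ ⊛-congˡ (H v k) JProd-J ⟩
      (J v ⊛ JProd v) ⊛ H v k      ≈⟨ ⊛-assoc (J v) (JProd v) (H v k) ⟩
      J v ⊛ (JProd v ⊛ H v k)      ∎
    second : JProd v ⊛ H u (suc k) ≋ R u (suc k) ⊛ J v
    second = begin
      JProd v ⊛ H u (suc k)            ≈⟨ ⊛-congˡ (H u (suc k)) (JProd-rec u⋖v) ⟩
      (JProd u ⊛ J v) ⊛ H u (suc k)    ≈⟨ ⊛-assoc (JProd u) (J v) (H u (suc k)) ⟩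
      JProd u ⊛ (J v ⊛ H u (suc k))    ≈⟨ ⊛-congʳ (JProd u) (J-comm-below v (H u (suc k)) (SumBelow-H u<v (suc k))) ⟩
      JProd u ⊛ (H u (suc k) ⊛ J v)    ≈⟨ ≋-sym (⊛-assoc (JProd u) (H u (suc k)) (J v)) ⟩
      (JProd u ⊛ H u (suc k)) ⊛ J v    ∎

R-zero-0 : ∀ {m} → R {suc m} zero 0 ≋ ε
R-zero-0 {m} = ≋-trans (⊛-identityʳ (JProd zero)) (≋-reflexive (cong expandMono nothing-below))
  where
  nothing-below : JProdIndices {suc m} zero ≡ []
  nothing-below = filter-none (_≤? zero {n = m}) {xs = tabulate {n = m} suc} (All.tabulate⁺ (λ i ()))

R-zero-suc : ∀ {m} k → R {suc m} zero (suc k) ≋ []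
R-zero-suc k = ≋-trans (⊛-congʳ (JProd zero) (H-zero-suc k)) (⊛-zeroʳ (JProd zero))

Spanning-small : ∀ {c} (v : Fin n) → toℕ v ≡ suc c → ∀ t → t ℕ.≤ c → Spanning v t ≋ []
Spanning-small v v≡1+c zero    _ with predecessor v v≡1+c
... | u , u⋖v , _ = Spanning-⋖-0 u⋖v
Spanning-small {c = suc c} v v≡2+c (suc t) (ℕ.s≤s t≤c) with predecessor v v≡2+c
... | u , u⋖v , u≡1+c = ≋-trans (Spanning-rec u v u⋖v (central u) t)
  (++-cong (≋-trans (⊛-congʳ (J v) (Spanning-small v v≡2+c t (ℕₚ.m≤n⇒m≤1+n t≤c))) (⊛-zeroʳ (J v)))
           (⊛-congˡ (J v) (Spanning-small u u≡1+c t t≤c)))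

Spanning≋R : ∀ c (v : Fin n) → toℕ v ≡ c → ∀ k → Spanning v (c + k) ≋ R v k
Spanning≋R zero    zero    refl zero    = ≋-trans Spanning-zero-0 (≋-sym R-zero-0)
Spanning≋R zero    zero    refl (suc k) = ≋-trans (Spanning-zero-suc k) (≋-sym (R-zero-suc k))
Spanning≋R (suc c) v v≡1+c with predecessor v v≡1+c
... | u , u⋖v , u≡c = go
  where
  go : ∀ k → Spanning v (suc c + k) ≋ R v k
  go zero    = begin
      Spanning v (suc c + 0)                                 ≈⟨ Spanning-rec u v u⋖v (central u) (c + 0) ⟩
      J v ⊛ Spanning v (c + 0) ++ Spanning u (c + 0) ⊛ J v   ≈⟨ ++-cong (≋-trans (⊛-congʳ (J v) too-short) (⊛-zeroʳ (J v)))
                                                                       (⊛-congˡ (J v) (Spanning≋R c u u≡c 0)) ⟩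
      R u 0 ⊛ J v                                            ≈⟨ ≋-sym (R-rec₀ u⋖v) ⟩
      R v 0                                                  ∎
    where
    open SetoidReasoning (≋-setoid _)
    too-short : Spanning v (c + 0) ≋ []
    too-short = Spanning-small v v≡1+c (c + 0) (ℕₚ.≤-reflexive (+-identityʳ c))
  go (suc k) = begin
      Spanning v (suc c + suc k)                                   ≡⟨ cong (Spanning v) (ℕₚ.+-suc (suc c) k) ⟩
      Spanning v (suc (suc c + k))                                 ≈⟨ Spanning-rec u v u⋖v (central u) (suc c + k) ⟩
      J v ⊛ Spanning v (suc c + k) ++ Spanning u (suc c + k) ⊛ J v ≈⟨ ++-cong (⊛-congʳ (J v) (go k)) (⊛-congˡ (J v) IH) ⟩
      J v ⊛ R v k ++ R u (suc k) ⊛ J v                             ≈⟨ ≋-sym (R-rec u⋖v k) ⟩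
      R v (suc k)                                                  ∎
    where
    open SetoidReasoning (≋-setoid _)
    IH : Spanning u (suc c + k) ≋ R u (suc k)
    IH = subst (λ t → Spanning u t ≋ R u (suc k)) (ℕₚ.+-suc c k) (Spanning≋R c u u≡c (suc k))

-- Transitivity of star words

∈-star⁻ : {v : Fin n} {s : List (Fin n)} {τ : Transp n} → τ ∈ star v s → Σ (Fin n) (λ b → b ∈ s × τ ≡ (b , v))
∈-star⁻ τ∈ with ∈-map⁻ (λ a → (a , _)) τ∈
... | b , b∈s , τ≡ = b , b∈s , τ≡

fixed-by-star : (v a : Fin n) (s : List (Fin n)) → a ≢ v → a ∉ s →
                ∀ g → All (_∈ star v s) g → act g a ≡ a
fixed-by-star v a s a≢v a∉s []      []         = refl
fixed-by-star v a s a≢v a∉s (τ ∷ g) (τ∈ ∷ g∈) with ∈-star⁻ τ∈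
... | b , b∈s , refl = trans (cong (act g) (swapT-other b v a (λ { refl → a∉s b∈s }) a≢v)) (fixed-by-star v a s a≢v a∉s g g∈)

transitive⇒spanning : (v : Fin n) (s : List (Fin n)) → GeneratesTransitive (star v s) → ∀ a → a ≢ v → a ∈ s
transitive⇒spanning v s transitive a a≢v with any? (a ≟_) s
... | yes a∈s = a∈s
... | no  a∉s with transitive a v
...   | g , g∈ , ga≡v = ⊥-elim (a≢v (trans (sym (fixed-by-star v a s a≢v a∉s g g∈)) ga≡v))

spanning⇒transitive : (v : Fin n) (s : List (Fin n)) → (∀ a → a ≢ v → a ∈ s) → GeneratesTransitive (star v s)
spanning⇒transitive v s spanning x y =
  hop x ++ hop y , All.++⁺ (hop-∈ x) (hop-∈ y) ,
  trans (act-++ (hop x) (hop y) x) (trans (cong (act (hop y)) (hop-there x)) (hop-back y))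
  where
  hop : Fin _ → Word _
  hop x with x ≟ v
  ... | yes _ = []
  ... | no  _ = (x , v) ∷ []
  hop-there : ∀ x → act (hop x) x ≡ v
  hop-there x with x ≟ v
  ... | yes x≡v = x≡v
  ... | no  _   = swapT-fst x v
  hop-back : ∀ y → act (hop y) v ≡ y
  hop-back y with y ≟ v
  ... | yes y≡v = sym y≡v
  ... | no  _   = swapT-snd y v
  hop-∈ : ∀ x → All (_∈ star v s) (hop x)
  hop-∈ x with x ≟ v
  ... | yes _   = []
  ... | no  x≢v = ∈-map⁺ (λ a → (a , v)) (spanning x x≢v) ∷ []

∈ᵇ⇒∈ : {a : Fin n} (s : List (Fin n)) → (a ∈ᵇ s) ≡ true → a ∈ s
∈ᵇ⇒∈ {a = a} (b ∷ s) e with a ≟ b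
... | yes a≡b = here a≡b
... | no  _   = there (∈ᵇ⇒∈ s e)

∈⇒∈ᵇ : {a : Fin n} {s : List (Fin n)} → a ∈ s → (a ∈ᵇ s) ≡ true
∈⇒∈ᵇ {a = a} {s = _ ∷ s} (here refl) = ∈ᵇ-head a s
∈⇒∈ᵇ {a = a} {s = b ∷ s} (there a∈s) = trans (cong ((a == b) ∨_) (∈⇒∈ᵇ a∈s)) (∨-zeroʳ (a == b))

∉⇒∈ᵇ-false : {a : Fin n} (s : List (Fin n)) → a ∉ s → (a ∈ᵇ s) ≡ false
∉⇒∈ᵇ-false {a = a} s a∉s with a ∈ᵇ s in e
... | true  = ⊥-elim (a∉s (∈ᵇ⇒∈ s e))
... | false = refl

star-words : ∀ t (v : Fin n) → All (λ w → Σ (List (Fin n)) (λ s → w ≡ star v s × All (_< v) s)) (expandMono (replicate t v))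
star-words         zero    v = ([] , refl , []) ∷ []
star-words {n = n} (suc t) v =
  All-concatMap (λ τ → map (τ ∷_) (expandMono (replicate t v))) (expandJ v)
    (All.map⁺ (All.map (λ {j} j<v → All.map⁺ (All.map (λ { (s , refl , s<v) → j ∷ s , refl , j<v ∷ s<v }) (star-words t v)))
                       (all-filter (_<? v) (allFin n))))

_≟ₜ_ : (σ τ : Transp n) → Dec (σ ≡ τ)
_≟ₜ_ = ×-≡-dec _≟_ _≟_

module _ {m : ℕ} where

  private
    N : Fin (suc (suc m))
    N = fromℕ (suc m)

    ≢N⇒<N : {a : Fin (suc (suc m))} → a ≢ N → a < N
    ≢N⇒<N {a} a≢N = ℕₚ.≤∧≢⇒< (subst (toℕ a ℕ.≤_) (sym (toℕ-fromℕ (suc m))) (toℕ≤pred[n] a)) (a≢N ∘ toℕ-injective)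

  -- A decidable stand-in for transitivity on the star words of J_N^t, N the last point.
  Joined : Word (suc (suc m)) → Set
  Joined w = ∀ a → a ≢ N → (a , N) ∈ w

  joined? : (w : Word (suc (suc m))) → Dec (Joined w)
  joined? w = all? (λ a → ¬? (a ≟ N) →-dec any? ((a , N) ≟ₜ_) w)

  joined-centre : (v : Fin (suc (suc m))) (s : List (Fin (suc (suc m)))) → Joined (star v s) → v ≡ N
  joined-centre v s joined with ∈-star⁻ (joined zero (λ ()))
  ... | _ , _ , refl = refl

  transitive⇔joined : (v : Fin (suc (suc m))) (s : List (Fin (suc (suc m)))) → All (_< v) s →
                      GeneratesTransitive (star v s) ⇔ Joined (star v s)
  transitive⇔joined v s s<v with v ≟ N
  ... | yes refl = mk⇔ (λ tr a a≢N → ∈-map⁺ (λ b → (b , N)) (transitive⇒spanning N s tr a a≢N))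
                       (λ joined → spanning⇒transitive N s λ a a≢N → leaf (joined a a≢N))
    where
    leaf : ∀ {a} → (a , N) ∈ star N s → a ∈ s
    leaf a∈ with ∈-star⁻ a∈
    ... | b , b∈s , refl = b∈s
  ... | no v≢N = mk⇔ (λ tr → ⊥-elim (N-isolated tr)) (λ joined → ⊥-elim (v≢N (joined-centre v s joined)))
    where
    N∉s : N ∉ s
    N∉s N∈s = ℕₚ.<⇒≱ (All.lookup s<v N∈s) (subst (toℕ v ℕ.≤_) (sym (toℕ-fromℕ (suc m))) (toℕ≤pred[n] v))
    N-isolated : ¬ GeneratesTransitive (star v s)
    N-isolated tr with tr N zero
    ... | g , g∈ , gN≡0 = case trans (sym (fixed-by-star v N s (v≢N ∘ sym) N∉s g g∈)) gN≡0 of λ ()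

  spanning⇔joined : (s : List (Fin (suc (suc m)))) → (All (_< N) s × Joined (star N s)) ⇔ HasElems (below N) s
  spanning⇔joined s = mk⇔ to from
    where
    to : All (_< N) s × Joined (star N s) → HasElems (below N) s
    to (s<N , joined) a with a <? N
    ... | yes a<N = trans (∈⇒∈ᵇ (leaf (joined a (λ { refl → ℕₚ.<-irrefl refl a<N })))) (sym (dec-true (a <? N) a<N))
      where
      leaf : (a , N) ∈ star N s → a ∈ s
      leaf a∈ with ∈-star⁻ a∈
      ... | b , b∈s , refl = b∈s
    ... | no  a≮N = trans (∉⇒∈ᵇ-false s (λ a∈s → a≮N (All.lookup s<N a∈s))) (sym (dec-false (a <? N) a≮N))
    from : HasElems (below N) s → All (_< N) s × Joined (star N s)
    from spans = All.tabulate (λ {a} a∈s → true⇒ (a <? N) (trans (sym (spans a)) (∈⇒∈ᵇ a∈s))) ,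
                 λ a a≢N → ∈-map⁺ (λ b → (b , N)) (∈ᵇ⇒∈ s (trans (spans a) (dec-true (a <? N) (≢N⇒<N a≢N))))

  mult-joined-replicate : ∀ t (v : Fin (suc (suc m))) f →
    ∑ (expandMono (replicate t v)) (λ w → when (does (joined? w)) (δ w f)) ≡ when (v == N) (mult (Spanning N t) f)
  mult-joined-replicate t v f with v ≟ N
  ... | yes refl = trans (∑-expandMono-replicate t N _) (trans (∑-cong (seqs _ t) joined⇔spanning) (sym (∑-Stars N (hasElems (below N)) t _)))
    where
    joined⇔spanning : ∀ s → when (allBelow N s) (when (does (joined? (star N s))) (δ (star N s) f))
                           ≡ when (hasElems (below N) s) (δ (star N s) f)
    joined⇔spanning s = trans (sym (when-∧ (allBelow N s) _ _)) (cong (λ b → when b (δ (star N s) f))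
      (does-⇔ (spanning⇔joined s) (All.all? (_<? N) s ×-dec joined? (star N s)) (hasElems? (below N) s)))
  ... | no  v≢N  =
    trans (∑-expandMono-replicate t v _) (trans (∑-cong (seqs _ t) λ s → unjoined s (All.all? (_<? v) s)) (∑-zero (seqs _ t)))
    where
    unjoined : ∀ s (d : Dec (All (_< v) s)) → when (does d) (when (does (joined? (star v s))) (δ (star v s) f)) ≡ 0
    unjoined s (no _)    = refl
    unjoined s (yes s<v) = cong (λ b → when b (δ (star v s) f))
      (dec-false (joined? (star v s)) (λ joined → v≢N (joined-centre v s joined)))

  star-words-⇔ : ∀ t (v : Fin (suc (suc m))) → All (λ w → GeneratesTransitive w ⇔ Joined w) (expandMono (replicate t v))
  star-words-⇔ t v = All.map (λ { (s , refl , s<v) → transitive⇔joined v s s<v }) (star-words t v)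

  Tₙ-pSym : ∀ t → Tₙ (pSym (suc (suc m)) t) ≈GA ⟦ Spanning N t ⟧
  Tₙ-pSym t = ≈GA-trans (Tₙ≈filter joined? (pSym _ t) transitive⇔joined′) (≋⇒≈GA (mk≋ λ f → begin
      mult (filter joined? (expand (pSym _ t))) f
    ≡⟨ ∑-filter joined? (expand (pSym _ t)) _ ⟩
      ∑ (expand (pSym _ t)) (λ w → when (does (joined? w)) (δ w f))
    ≡⟨ ∑-concatMap expandMono (map (λ i → replicate t i) (allFin _)) (λ w → when (does (joined? w)) (δ w f)) ⟩
      ∑ (map (λ i → replicate t i) (allFin _)) (λ is → ∑ (expandMono is) (λ w → when (does (joined? w)) (δ w f)))
    ≡⟨ ∑-map (λ i → replicate t i) (allFin _) (λ is → ∑ (expandMono is) (λ w → when (does (joined? w)) (δ w f))) ⟩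
      ∑ (allFin _) (λ i → ∑ (expandMono (replicate t i)) (λ w → when (does (joined? w)) (δ w f)))
    ≡⟨ ∑-cong (allFin _) (λ i → mult-joined-replicate t i f) ⟩
      ∑ (allFin _) (λ i → when (i == N) (mult (Spanning N t) f))
    ≡⟨ ∑-δ _ N (λ _ → mult (Spanning N t) f) ⟩
      mult (Spanning N t) f ∎))
    where
    open ≡-Reasoning
    transitive⇔joined′ : All (λ w → GeneratesTransitive w ⇔ Joined w) (expand (pSym _ t))
    transitive⇔joined′ = All-concatMap expandMono (map (λ i → replicate t i) (allFin _))
                           (All.map⁺ {f = λ i → replicate t i} (All.tabulate⁺ (λ i → star-words-⇔ t i)))

  Tₙ-JlastPow : ∀ t → Tₙ (JlastPow (suc m) t) ≈GA ⟦ Spanning N t ⟧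
  Tₙ-JlastPow t = ≈GA-trans (Tₙ≈filter joined? (JlastPow (suc m) t) (All.++⁺ (star-words-⇔ t N) [])) (≋⇒≈GA (mk≋ λ f → begin
      mult (filter joined? (expandMono (replicate t N) ++ [])) f
    ≡⟨ ∑-filter joined? (expandMono (replicate t N) ++ []) _ ⟩
      ∑ (expandMono (replicate t N) ++ []) (λ w → when (does (joined? w)) (δ w f))
    ≡⟨ cong (λ ws → ∑ ws (λ w → when (does (joined? w)) (δ w f))) (++-identityʳ (expandMono (replicate t N))) ⟩
      ∑ (expandMono (replicate t N)) (λ w → when (does (joined? w)) (δ w f))
    ≡⟨ mult-joined-replicate t N f ⟩
      when (N == N) (mult (Spanning N t) f)
    ≡⟨ cong (λ b → when b (mult (Spanning N t) f)) (==-refl N) ⟩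
      mult (Spanning N t) f ∎))
    where open ≡-Reasoning

-- The elementary symmetric function e_{n-1}

expandMono-zero : ∀ {m} {s : JMono (suc m)} → zero ∈ s → expandMono s ≋ []
expandMono-zero {s = _ ∷ s} (here refl)      = ≋-trans (expandMono-∷ zero s) (⊛-congˡ (expandMono s) J-zero)
expandMono-zero {s = a ∷ s} (there zero∈s) =
  ≋-trans (expandMono-∷ a s) (≋-trans (⊛-congʳ (J a) (expandMono-zero zero∈s)) (⊛-zeroʳ (J a)))

range : ℕ → ℕ → List ℕ
range lo zero    = []
range lo (suc k) = lo ∷ range (suc lo) k

range-tabulate : ∀ {k} (f : Fin k → Fin n) lo → (∀ i → toℕ (f i) ≡ lo + toℕ i) → map toℕ (tabulate f) ≡ range lo k
range-tabulate {k = zero}  f lo e = refl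
range-tabulate {k = suc k} f lo e =
  cong₂ _∷_ (trans (e zero) (+-identityʳ lo)) (range-tabulate (f ∘ suc) (suc lo) (λ i → trans (e (suc i)) (ℕₚ.+-suc lo (toℕ i))))

range-Linked : (s : List (Fin n)) (lo k : ℕ) → map toℕ s ≡ range lo k → Linked _<_ s
range-Linked []          lo k             e = []
range-Linked (a ∷ [])     lo k             e = [-]
range-Linked (a ∷ b ∷ s) lo (suc (suc k)) e = a<b ∷ range-Linked (b ∷ s) (suc lo) (suc k) (Listₚ.∷-injectiveʳ e)
  where
  a<b : a < b
  a<b = subst (ℕ._< toℕ b) (sym (Listₚ.∷-injectiveˡ e)) (ℕₚ.≤-reflexive (sym (Listₚ.∷-injectiveˡ (Listₚ.∷-injectiveʳ e))))

Linked-<-bound : (a : Fin n) (s : List (Fin n)) → Linked _<_ (a ∷ s) → length s + toℕ a ℕ.< n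
Linked-<-bound a []      _           = Fₚ.toℕ<n a
Linked-<-bound a (b ∷ s) (a<b ∷ rest) =
  ℕₚ.≤-<-trans (ℕₚ.≤-reflexive (sym (ℕₚ.+-suc (length s) (toℕ a)))) (ℕₚ.≤-<-trans (ℕₚ.+-monoʳ-≤ (length s) a<b) (Linked-<-bound b s rest))

Linked-<-range : (s : List (Fin n)) (lo : ℕ) → Linked _<_ s → All (λ x → lo ℕ.≤ toℕ x) s → length s + lo ≡ n →
                 map toℕ s ≡ range lo (length s)
Linked-<-range []      lo _      _            _    = refl
Linked-<-range (a ∷ s) lo linked (lo≤a ∷ lo≤s) size =
  cong₂ _∷_ a≡lo (Linked-<-range s (suc lo) (Linked.tail linked) above (trans (ℕₚ.+-suc (length s) lo) size))
  where
  a≡lo : toℕ a ≡ lo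
  a≡lo = ℕₚ.≤-antisym (ℕₚ.+-cancelˡ-≤ (length s) (toℕ a) lo (ℕₚ.≤-pred (subst (length s + toℕ a ℕ.<_) (sym size) bound))) lo≤a
    where bound = Linked-<-bound a s linked
  above : All (λ x → suc lo ℕ.≤ toℕ x) s
  above = All.map (λ a<x → subst (λ z → suc z ℕ.≤ _) a≡lo a<x) (head-below linked)
    where
    head-below : ∀ {a s} → Linked _<_ (a ∷ s) → All (a <_) s
    head-below [-]          = []
    head-below (a<b ∷ rest) = Linked⇒All ℕₚ.<-trans a<b rest

seqs-length : ∀ n k → All (λ s → length s ≡ k) (seqs n k)
seqs-length n zero    = refl ∷ []
seqs-length n (suc k) = All-concatMap (λ i → map (i ∷_) (seqs n k)) (allFin n)
                          (All.tabulate⁺ (λ i → All.map⁺ (All.map (cong suc) (seqs-length n k))))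

∑-seqs-δ : ∀ n k (s₀ : JMono n) → length s₀ ≡ k → (G : JMono n → ℕ) →
           ∑ (seqs n k) (λ s → when (does (Listₚ.≡-dec _≟_ s s₀)) (G s)) ≡ G s₀
∑-seqs-δ n zero    []       _    G = +-identityʳ (G [])
∑-seqs-δ n (suc k) (a ∷ s₀) size G = begin
    ∑ (seqs n (suc k)) (λ s → when (does (Listₚ.≡-dec _≟_ s (a ∷ s₀))) (G s))
  ≡⟨ ∑-seqs-suc n k _ ⟩
    ∑ (allFin n) (λ i → ∑ (seqs n k) (λ s → when (does (Listₚ.≡-dec _≟_ (i ∷ s) (a ∷ s₀))) (G (i ∷ s))))
  ≡⟨ ∑-cong (allFin n) (λ i → ∑-cong (seqs n k) (λ s → trans
       (cong (λ b → when b (G (i ∷ s))) (does-⇔ (mk⇔ ∷-injective (λ (p , q) → cong₂ _∷_ p q))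
                                                 (Listₚ.≡-dec _≟_ (i ∷ s) (a ∷ s₀)) ((i ≟ a) ×-dec Listₚ.≡-dec _≟_ s s₀)))
       (when-∧ (i == a) _ _))) ⟩
    ∑ (allFin n) (λ i → ∑ (seqs n k) (λ s → when (i == a) (when (does (Listₚ.≡-dec _≟_ s s₀)) (G (i ∷ s)))))
  ≡⟨ ∑-cong (allFin n) (λ i → trans (∑-when (seqs n k) (i == a) _) (cong (when (i == a)) (∑-seqs-δ n k s₀ (ℕₚ.suc-injective size) _))) ⟩
    ∑ (allFin n) (λ i → when (i == a) (G (i ∷ s₀)))
  ≡⟨ ∑-δ n a (λ i → G (i ∷ s₀)) ⟩
    G (a ∷ s₀) ∎
  where open ≡-Reasoning

-- As J₀ = 0, only the monomial J₁ ⋯ J_{n-1} of e_{n-1}(J₀, …, J_{n-1}) survives.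
eSym≋J2toJn : ∀ K → expand (eSym (suc K) K) ≋ expand (J2toJn (suc K))
eSym≋J2toJn K = mk≋ λ f → begin
    mult (expand (eSym (suc K) K)) f
  ≡⟨ mult-concatMap-filter (linked? _<?_) expandMono (seqs (suc K) K) f ⟩
    ∑ (seqs (suc K) K) (λ s → when (does (linked? _<?_ s)) (mult (expandMono s) f))
  ≡⟨ ∑-congᴬ (seqs (suc K) K) (seqs-length (suc K) K)
             (λ s size → only-s₀ s size (mult (expandMono s) f) (λ zero∈s → mult≡ (expandMono-zero zero∈s) f)) ⟩
    ∑ (seqs (suc K) K) (λ s → when (does (Listₚ.≡-dec _≟_ s s₀)) (mult (expandMono s) f))
  ≡⟨ ∑-seqs-δ (suc K) K s₀ s₀-length (λ s → mult (expandMono s) f) ⟩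
    mult (expandMono s₀) f
  ≡⟨ cong (λ ws → mult ws f) (sym (++-identityʳ (expandMono s₀))) ⟩
    mult (expand (J2toJn (suc K))) f ∎
  where
  open ≡-Reasoning
  s₀ : JMono (suc K)
  s₀ = drop 1 (allFin (suc K))
  s₀-range : map toℕ s₀ ≡ range 1 K
  s₀-range = range-tabulate suc 1 (λ i → refl)
  s₀-length : length s₀ ≡ K
  s₀-length = trans (sym (Listₚ.length-map toℕ s₀)) (trans (cong length s₀-range) (range-length 1 K))
    where
    range-length : ∀ lo k → length (range lo k) ≡ k
    range-length lo zero    = refl
    range-length lo (suc k) = cong suc (range-length (suc lo) k)
  sorted⇔s₀ : ∀ s → length s ≡ K → zero ∉ s → Linked _<_ s ⇔ (s ≡ s₀)
  sorted⇔s₀ s size zero∉s = mk⇔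
    (λ sorted → map-injective toℕ-injective (trans (Linked-<-range s 1 sorted (All.tabulate positive) (trans (+-comm (length s) 1) (cong suc size)))
                                              (trans (cong (range 1) size) (sym s₀-range))))
    (λ { refl → range-Linked s₀ 1 K s₀-range })
    where
    positive : ∀ {a} → a ∈ s → 1 ℕ.≤ toℕ a
    positive {zero}  zero∈s = ⊥-elim (zero∉s zero∈s)
    positive {suc a} _      = ℕ.s≤s ℕ.z≤n
  only-s₀ : ∀ s → length s ≡ K → ∀ X → (zero ∈ s → X ≡ 0) →
            when (does (linked? _<?_ s)) X ≡ when (does (Listₚ.≡-dec _≟_ s s₀)) X
  only-s₀ s size X vanishes with any? (zero ≟_) s
  ... | yes zero∈s = trans (cong (when _) (vanishes zero∈s)) (trans (when-zero _) (sym (trans (cong (when _) (vanishes zero∈s)) (when-zero _))))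
  ... | no  zero∉s = cong (λ b → when b X) (does-⇔ (sorted⇔s₀ s size zero∉s) (linked? _<?_ s) (Listₚ.≡-dec _≟_ s s₀))

module _ {m : ℕ} where

  private
    N : Fin (suc (suc m))
    N = fromℕ (suc m)

    ≤N : (a : Fin (suc (suc m))) → a ≤ N
    ≤N a = subst (toℕ a ℕ.≤_) (sym (toℕ-fromℕ (suc m))) (toℕ≤pred[n] a)

  J2toJn≋JProd : expand (J2toJn (suc (suc m))) ≋ JProd N
  J2toJn≋JProd = ≋-reflexive (trans (++-identityʳ _) (cong expandMono (sym (filter-all (_≤? N) (All.tabulate⁺ (λ i → ≤N (suc i)))))))

  hSym≋H : ∀ k → expand (hSym (suc (suc m)) k) ≋ H N k
  hSym≋H k = mk≋ λ f →
    trans (mult-concatMap-filter (linked? _≤?_) expandMono (seqs _ k) f)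
      (trans (∑-cong (seqs _ k) (λ s → cong (λ b → when b (mult (expandMono s) f))
                (does-⇔ (mk⇔ (λ sorted → sorted , All.tabulate (λ {a} _ → ≤N a)) proj₁) (linked? _≤?_ s) (sorted? N s))))
        (sym (mult-concatMap-filter (sorted? N) expandMono (seqs _ k) f)))

  Spanning≋e⊛h : ∀ k → Spanning N (suc m + k) ≋ expand (J2toJn (suc (suc m))) ⊛ expand (hSym (suc (suc m)) k)
  Spanning≋e⊛h k = ≋-trans (Spanning≋R (suc m) N (toℕ-fromℕ (suc m)) k) (⊛-cong (≋-sym J2toJn≋JProd) (≋-sym (hSym≋H k)))

corollary1p5 : (m k : ℕ) →
    (Tₙ (pSym (suc (suc m)) (suc m + k)) ≈GA Tₙ (JlastPow (suc m) (suc m + k)))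
    × (Tₙ (JlastPow (suc m) (suc m + k)) ≈GA evalMul (J2toJn (suc (suc m))) (hSym (suc (suc m)) k))
    × (evalMul (J2toJn (suc (suc m))) (hSym (suc (suc m)) k) ≈GA evalMul (eSym (suc (suc m)) (suc m)) (hSym (suc (suc m)) k))
corollary1p5 m k =
    ≈GA-trans (Tₙ-pSym t) (≈GA-sym (Tₙ-JlastPow t))
  , ≈GA-trans (Tₙ-JlastPow t) (≋⇒≈GA (Spanning≋e⊛h k))
  , ≋⇒≈GA (⊛-congˡ (expand (hSym (suc (suc m)) k)) (≋-sym (eSym≋J2toJn (suc m))))
  where
  t = suc m + k
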